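{- Let $p\ge 3$ be an integer and let $F_p$ be the plane graph constructed as follows. Take a cycle $C=u_0u_1\ldots u_{p-1}u_0$ of length $p$. Inside $C$ add a cycle $C'=v_0v_1\ldots v_{2p-1}v_0$ of length $2p$ and edges $u_iv_{2i-1}, u_iv_{2i}, u_iv_{2i+1}$ for $i=0,1,\ldots,p-1$ (indices of $u$ modulo $p$, indices of $v$ modulo $2p$). Inside $C'$ add a cycle $C''=w_0w_1\ldots w_{2p-1}w_0$ of length $2p$ and edges $v_iw_i, v_iw_{i+1}$ for $i=0,\ldots,2p-1$ (indices modulo $2p$). Inside $C''$ add a new vertex $z$ adjacent to every vertex of $C''$. Then: (a) $\kappa(F_p)\ge 5$, i.e. $F_p$ is $5$-connected. (b) If $u\in V(F_p)$ and $M\subseteq V(C)$ with $|M|\le 5$, then $F_p$ contains a $(u,M)$-fan. (c) If $M_1,M_2\subseteq V(C)$ are two sets with $|M_1|=|M_2|\le 5$, then $F_p$ contains a set of $|M_1|$ disjoint paths from $M_1$ to $M_2$.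
   Context: $\kappa(G)$ denotes the vertex connectivity of $G$ (the minimum number of vertices whose deletion disconnects $G$). For a vertex $w$ of a graph $G$ and a set $A\subseteq V(G)$, a $(w,A)$-fan is a set of $|A|$ paths from $w$ to $A$ (one ending at each vertex of $A$) such that any two of them have only $w$ in common. -}

module Defs where

open import Data.Nat using (ℕ; zero; suc; _+_; _*_; _<_; _≤_)
open import Data.Fin using (Fin; toℕ)
open import Data.List using (List; length; lookup; head; last)
open import Data.List.Membership.Propositional using (_∈_; _∉_)
open import Data.List.Relation.Unary.All using (All)
open import Data.List.Relation.Unary.Linked using (Linked)
open import Data.List.Relation.Unary.Unique.Propositional using (Unique)
open import Data.Maybe using (just)
open import Data.Product using (Σ; ∃; _×_)
open import Data.Sum using (_⊎_)
open import Data.Unit using (⊤)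
open import Relation.Binary.PropositionalEquality using (_≡_; _≢_)

SuccMod : ℕ → ℕ → ℕ → Set
SuccMod n i j = (suc i < n × j ≡ suc i) ⊎ (suc i ≡ n × j ≡ 0)

data V (p : ℕ) : Set where
  cu : Fin p → V p
  cv : Fin (2 * p) → V p
  cw : Fin (2 * p) → V p
  cz : V p

-- the (undirected) edges of F_p, each listed in one orientation
data Edge (p : ℕ) : V p → V p → Set where
  uu   : (i j : Fin p) → SuccMod p (toℕ i) (toℕ j) → Edge p (cu i) (cu j)
  -- u_i v_{2i}, u_i v_{2i+1}, u_i v_{2i-1}
  uv0  : (i : Fin p) (j : Fin (2 * p)) → toℕ j ≡ 2 * toℕ i → Edge p (cu i) (cv j)
  uv+  : (i : Fin p) (j : Fin (2 * p)) → toℕ j ≡ suc (2 * toℕ i) → Edge p (cu i) (cv j)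
  uv-  : (i : Fin p) (j : Fin (2 * p)) → SuccMod (2 * p) (toℕ j) (2 * toℕ i) → Edge p (cu i) (cv j)
  vv   : (i j : Fin (2 * p)) → SuccMod (2 * p) (toℕ i) (toℕ j) → Edge p (cv i) (cv j)
  vw0  : (i : Fin (2 * p)) → Edge p (cv i) (cw i)
  vw+  : (i j : Fin (2 * p)) → SuccMod (2 * p) (toℕ i) (toℕ j) → Edge p (cv i) (cw j)
  ww   : (i j : Fin (2 * p)) → SuccMod (2 * p) (toℕ i) (toℕ j) → Edge p (cw i) (cw j)
  wz   : (i : Fin (2 * p)) → Edge p (cw i) cz

Adj : (p : ℕ) → V p → V p → Set
Adj p x y = Edge p x y ⊎ Edge p y x

IsPath : (p : ℕ) → V p → V p → List (V p) → Set
IsPath p a b xs = head xs ≡ just a × last xs ≡ just b × Linked (Adj p) xs × Unique xs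

OnC : {p : ℕ} → V p → Set
OnC {p} x = ∃ λ (i : Fin p) → x ≡ cu i

KappaAtLeast5 : ℕ → Set
KappaAtLeast5 p = (S : List (V p)) → length S ≤ 4 →
  (x y : V p) → x ∉ S → y ∉ S →
  Σ (List (V p)) λ P → IsPath p x y P × All (λ t → t ∉ S) P

Fan : (p : ℕ) → V p → List (V p) → Set
Fan p w M = Σ (Fin (length M) → List (V p)) λ P →
  ((k : Fin (length M)) → IsPath p w (lookup M k) (P k)) ×
  ((k l : Fin (length M)) → k ≢ l → (t : V p) → t ∈ P k → t ∈ P l → t ≡ w)

DisjointPaths : (p : ℕ) → (M1 M2 : List (V p)) → Set
DisjointPaths p M1 M2 =
  Σ (Fin (length M1) → Fin (length M2)) λ σ →
  Σ (Fin (length M1) → List (V p)) λ P →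
  ((k : Fin (length M1)) → IsPath p (lookup M1 k) (lookup M2 (σ k)) (P k)) ×
  ((k l : Fin (length M1)) → k ≢ l → (t : V p) → t ∈ P k → t ∉ P l)

module Submission where

-- Parts (b) and (c) hold in every finite graph with κ > 4 and do not need M ⊆ V(C):
-- they follow from Menger's theorem, because a separator of fewer than |M| ≤ 5
-- vertices would miss a vertex of each end set, contradicting 5-connectivity.

open import Defs
open import Data.Nat using (ℕ; _≤_)
open import Data.List using (List; length)
open import Data.List.Relation.Unary.All using (All)
open import Data.List.Relation.Unary.Unique.Propositional using (Unique)
open import Data.Product using (_×_; _,_)
open import Relation.Binary.PropositionalEquality using (_≡_)
open import Data.List.Membership.Propositional using (_∈_)
open import Relation.Nullary using (Dec)
open import Relation.Binary.Definitions using (DecidableEquality)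

module Walks {Vert : Set} (_≟_ : DecidableEquality Vert) where
  open import Data.Nat using (zero; suc; _≤_; _<_)
  open import Data.Nat.Properties using (≤-trans; <-≤-trans; <⇒≱; ≤-pred; 1+n≰n)
  open import Data.Fin using (Fin; zero; suc)
  open import Data.Fin.Properties using (injective⇒≤; any?)
  open import Data.List using (List; []; _∷_; length; lookup; head; last; filter)
  open import Data.List.Properties using (filter-notAll)
  open import Data.List.Membership.Propositional using (_∈_; _∉_; find)
  open import Data.List.Membership.Propositional.Properties using (∈-lookup; ∈-filter⁺; ∈-filter⁻)
  open import Data.List.Relation.Binary.Subset.Propositional using (_⊆_)
  open import Data.List.Relation.Unary.Any using (Any; here; there; index)
  open import Data.List.Relation.Unary.Any.Properties using (lookup-index)
  open import Data.List.Relation.Unary.All using (All; []; _∷_)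
  import Data.List.Relation.Unary.All as All
  open import Data.List.Relation.Unary.All.Properties using (¬Any⇒All¬; ¬All⇒Any¬)
  open import Data.List.Relation.Unary.AllPairs using (AllPairs; []; _∷_)
  open import Data.List.Relation.Unary.Linked using (Linked; []; [-]; _∷_)
  open import Data.List.Relation.Unary.Unique.Propositional using (Unique)
  open import Data.Maybe using (just)
  open import Data.Product using (Σ; _×_; _,_; proj₁; proj₂)
  open import Data.Sum using (_⊎_; inj₁; inj₂; [_,_]′)
  open import Data.Empty using (⊥-elim)
  open import Function using (_∘_; id)
  open import Relation.Nullary using (Dec; yes; no)
  open import Relation.Nullary.Decidable using (¬?; decidable-stable)
  open import Relation.Binary.PropositionalEquality using (_≡_; _≢_; refl; sym; trans; cong)

  open import Data.List.Membership.DecPropositional _≟_ using (_∈?_)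

  Graph : Set₁
  Graph = Vert → Vert → Set

  Avoids : List Vert → List Vert → Set
  Avoids S xs = All (_∉ S) xs

  avoids-∈ : ∀ {S xs t} → Avoids S xs → t ∈ xs → t ∉ S
  avoids-∈ av = All.lookup av

  avoids-tail : ∀ {x S xs} → Avoids (x ∷ S) xs → Avoids S xs
  avoids-tail = All.map (λ t∉ → t∉ ∘ there)

  IsPathIn : Graph → Vert → Vert → List Vert → Set
  IsPathIn G a b xs = head xs ≡ just a × last xs ≡ just b × Linked G xs × Unique xs

  infixr 5 _∷⟨_⟩_

  data Walk (G : Graph) : Vert → Vert → Set where
    [_]    : (a : Vert) → Walk G a a
    _∷⟨_⟩_ : (a : Vert) {b c : Vert} → G a b → Walk G b c → Walk G a c

  module _ {G : Graph} where

    verts : ∀ {a b} → Walk G a b → List Vert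
    verts [ a ] = a ∷ []
    verts (a ∷⟨ _ ⟩ w) = a ∷ verts w

    initV : ∀ {a b} → Walk G a b → List Vert
    initV [ a ] = []
    initV (a ∷⟨ _ ⟩ w) = a ∷ initV w

    tailV : ∀ {a b} → Walk G a b → List Vert
    tailV [ a ] = []
    tailV (a ∷⟨ _ ⟩ w) = verts w

    start∈ : ∀ {a b} (w : Walk G a b) → a ∈ verts w
    start∈ [ a ] = here refl
    start∈ (a ∷⟨ _ ⟩ w) = here refl

    end∈ : ∀ {a b} (w : Walk G a b) → b ∈ verts w
    end∈ [ a ] = here refl
    end∈ (a ∷⟨ _ ⟩ w) = there (end∈ w)

    init⊆ : ∀ {a b} (w : Walk G a b) → initV w ⊆ verts w
    init⊆ (a ∷⟨ _ ⟩ w) (here e) = here e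
    init⊆ (a ∷⟨ _ ⟩ w) (there m) = there (init⊆ w m)

    tail⊆ : ∀ {a b} (w : Walk G a b) → tailV w ⊆ verts w
    tail⊆ (a ∷⟨ _ ⟩ w) m = there m

    init-or-end : ∀ {a b t} (w : Walk G a b) → t ∈ verts w → t ∈ initV w ⊎ t ≡ b
    init-or-end [ a ] (here e) = inj₂ e
    init-or-end (a ∷⟨ _ ⟩ w) (here e) = inj₁ (here e)
    init-or-end (a ∷⟨ _ ⟩ w) (there m) with init-or-end w m
    ... | inj₁ m' = inj₁ (there m')
    ... | inj₂ e = inj₂ e

    start-or-tail : ∀ {a b t} (w : Walk G a b) → t ∈ verts w → t ≡ a ⊎ t ∈ tailV w
    start-or-tail [ a ] (here e) = inj₁ e
    start-or-tail (a ∷⟨ _ ⟩ w) (here e) = inj₁ e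
    start-or-tail (a ∷⟨ _ ⟩ w) (there m) = inj₂ m

    infixr 5 _++w_
    _++w_ : ∀ {a b c} → Walk G a b → Walk G b c → Walk G a c
    [ a ] ++w w₂ = w₂
    (a ∷⟨ r ⟩ w₁) ++w w₂ = a ∷⟨ r ⟩ (w₁ ++w w₂)

    ++w-∈ : ∀ {a b c t} (w₁ : Walk G a b) (w₂ : Walk G b c) → t ∈ verts (w₁ ++w w₂) → t ∈ verts w₁ ⊎ t ∈ verts w₂
    ++w-∈ [ a ] w₂ m = inj₂ m
    ++w-∈ (a ∷⟨ r ⟩ w₁) w₂ (here e) = inj₁ (here e)
    ++w-∈ (a ∷⟨ r ⟩ w₁) w₂ (there m) with ++w-∈ w₁ w₂ m
    ... | inj₁ m' = inj₁ (there m')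
    ... | inj₂ m' = inj₂ m'

    ++w-avoids : ∀ {S a b c} (w₁ : Walk G a b) (w₂ : Walk G b c) →
                 Avoids S (verts w₁) → Avoids S (verts w₂) → Avoids S (verts (w₁ ++w w₂))
    ++w-avoids w₁ w₂ av₁ av₂ = All.tabulate λ m → [ avoids-∈ av₁ , avoids-∈ av₂ ]′ (++w-∈ w₁ w₂ m)

    prefixTo : ∀ {a b t} (w : Walk G a b) → t ∈ initV w → Σ (Walk G a t) λ w₁ → verts w₁ ⊆ initV w
    prefixTo (a ∷⟨ r ⟩ w) (here refl) = [ a ] , λ { (here e) → here e }
    prefixTo (a ∷⟨ r ⟩ w) (there m) with prefixTo w m
    ... | w₁ , sub = (a ∷⟨ r ⟩ w₁) , λ { (here e) → here e ; (there q) → there (sub q) }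

    suffixFrom : ∀ {a b t} (w : Walk G a b) → t ∈ tailV w → Σ (Walk G t b) λ w₂ → verts w₂ ⊆ tailV w
    suffixFrom (a ∷⟨ r ⟩ w) m with start-or-tail w m
    ... | inj₁ refl = w , id
    ... | inj₂ m' with suffixFrom w m'
    ...   | w₂ , sub = w₂ , tail⊆ w ∘ sub

    FirstHit : ∀ {a b} → List Vert → Walk G a b → Set
    FirstHit {a} X w = Σ Vert λ c → c ∈ X × Σ (Walk G a c) λ w₁ → Avoids X (initV w₁) × verts w₁ ⊆ verts w

    firstHit : ∀ X {a b} (w : Walk G a b) → Avoids X (verts w) ⊎ FirstHit X w
    firstHit X [ a ] with a ∈? X
    ... | yes a∈ = inj₂ (a , a∈ , [ a ] , [] , id)
    ... | no a∉ = inj₁ (a∉ ∷ [])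
    firstHit X (a ∷⟨ r ⟩ w) with a ∈? X
    ... | yes a∈ = inj₂ (a , a∈ , [ a ] , [] , λ { (here e) → here e })
    ... | no a∉ with firstHit X w
    ...   | inj₁ av = inj₁ (a∉ ∷ av)
    ...   | inj₂ (c , c∈ , w₁ , av , sub) =
            inj₂ (c , c∈ , (a ∷⟨ r ⟩ w₁) , a∉ ∷ av , λ { (here e) → here e ; (there q) → there (sub q) })

    LastHit : ∀ {a b} → List Vert → Walk G a b → Set
    LastHit {b = b} X w = Σ Vert λ d → d ∈ X × Σ (Walk G d b) λ w₂ → Avoids X (tailV w₂) × verts w₂ ⊆ verts w

    lastHit : ∀ X {a b} (w : Walk G a b) → Avoids X (verts w) ⊎ LastHit X w
    lastHit X [ a ] with a ∈? X
    ... | yes a∈ = inj₂ (a , a∈ , [ a ] , [] , id)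
    ... | no a∉ = inj₁ (a∉ ∷ [])
    lastHit X (a ∷⟨ r ⟩ w) with lastHit X w
    ... | inj₂ (d , d∈ , w₂ , av , sub) = inj₂ (d , d∈ , w₂ , av , there ∘ sub)
    ... | inj₁ av with a ∈? X
    ...   | yes a∈ = inj₂ (a , a∈ , (a ∷⟨ r ⟩ w) , av , id)
    ...   | no a∉ = inj₁ (a∉ ∷ av)

    private
      dropTo : ∀ {a b c} (w : Walk G b c) → a ∈ verts w → Unique (verts w) →
               Σ (Walk G a c) λ w' → Unique (verts w') × verts w' ⊆ verts w
      dropTo [ b ] (here refl) u = [ b ] , u , id
      dropTo (b ∷⟨ r ⟩ w) (here refl) u = (b ∷⟨ r ⟩ w) , u , id
      dropTo (b ∷⟨ r ⟩ w) (there m) (_ ∷ u) with dropTo w m u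
      ... | w' , u' , sub = w' , u' , there ∘ sub

    shortcut : ∀ {a b} (w : Walk G a b) → Σ (Walk G a b) λ w' → Unique (verts w') × verts w' ⊆ verts w
    shortcut [ a ] = [ a ] , ([] ∷ []) , id
    shortcut (a ∷⟨ r ⟩ w) with shortcut w
    ... | w' , u , sub with a ∈? verts w'
    ...   | yes m = let (w'' , u'' , sub'') = dropTo w' m u in w'' , u'' , there ∘ sub ∘ sub''
    ...   | no a∉ = (a ∷⟨ r ⟩ w') , (¬Any⇒All¬ (verts w') a∉ ∷ u) ,
                    λ { (here e) → here e ; (there q) → there (sub q) }

    walk→path : ∀ {a b} (w : Walk G a b) → Unique (verts w) → IsPathIn G a b (verts w)
    walk→path w u = headW w , lastW w , linkedW w , u
      where
      headW : ∀ {a b} (w : Walk G a b) → head (verts w) ≡ just a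
      headW [ a ] = refl
      headW (a ∷⟨ r ⟩ w) = refl
      lastW : ∀ {a b} (w : Walk G a b) → last (verts w) ≡ just b
      lastW [ a ] = refl
      lastW (a ∷⟨ r ⟩ [ b ]) = refl
      lastW (a ∷⟨ r ⟩ (b ∷⟨ r' ⟩ w)) = lastW (b ∷⟨ r' ⟩ w)
      linkedW : ∀ {a b} (w : Walk G a b) → Linked G (verts w)
      linkedW [ a ] = [-]
      linkedW (a ∷⟨ r ⟩ [ b ]) = r ∷ [-]
      linkedW (a ∷⟨ r ⟩ (b ∷⟨ r' ⟩ w)) = r ∷ linkedW (b ∷⟨ r' ⟩ w)

    path→walk : ∀ {a b} xs → IsPathIn G a b xs → Σ (Walk G a b) λ w → verts w ≡ xs
    path→walk (x ∷ []) (refl , refl , _ , _) = [ x ] , refl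
    path→walk (x ∷ y ∷ xs) (refl , lst , r ∷ lk , _ ∷ u) with path→walk (y ∷ xs) (refl , lst , lk , u)
    ... | w , e = (x ∷⟨ r ⟩ w) , cong (x ∷_) e

    pathIn : ∀ {a b} (w : Walk G a b) → Σ (List Vert) λ P → IsPathIn G a b P × P ⊆ verts w
    pathIn w = let (w' , u , sub) = shortcut w in verts w' , walk→path w' u , sub

  cons-path : ∀ {G x a b} P → IsPathIn G a b P → G x a → x ∉ P → IsPathIn G x b (x ∷ P)
  cons-path (a ∷ P) (refl , last≡ , linked , u) r x∉ = refl , last≡ , r ∷ linked , ¬Any⇒All¬ (a ∷ P) x∉ ∷ u

  retarget : ∀ {G : Graph} {a b b'} → b ≡ b' → Walk G a b → Walk G a b'
  retarget refl w = w

  verts-retarget : ∀ {G : Graph} {a b b'} (e : b ≡ b') (w : Walk G a b) → verts (retarget e w) ≡ verts w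
  verts-retarget refl w = refl

  mapW : ∀ {G H : Graph} → (∀ {a b} → G a b → H a b) → ∀ {a b} → Walk G a b → Walk H a b
  mapW f [ a ] = [ a ]
  mapW f (a ∷⟨ r ⟩ w) = a ∷⟨ f r ⟩ mapW f w

  mapW-verts : ∀ {G H : Graph} (f : ∀ {a b} → G a b → H a b) {a b} (w : Walk G a b) → verts (mapW f w) ≡ verts w
  mapW-verts f [ a ] = refl
  mapW-verts f (a ∷⟨ r ⟩ w) = cong (a ∷_) (mapW-verts f w)

  reverseW : ∀ {G : Graph} → (∀ {a b} → G a b → G b a) → ∀ {a b} (w : Walk G a b) →
             Σ (Walk G b a) λ w' → verts w' ⊆ verts w
  reverseW symG [ a ] = [ a ] , id
  reverseW {G} symG (a ∷⟨ r ⟩ w) with reverseW symG w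
  ... | w' , sub = (w' ++w back-edge) , λ m → back (++w-∈ w' back-edge m)
    where
    back-edge : Walk G _ a
    back-edge = _ ∷⟨ symG r ⟩ [ a ]
    back : ∀ {t} → t ∈ verts w' ⊎ t ∈ verts back-edge → t ∈ verts (a ∷⟨ r ⟩ w)
    back (inj₁ m) = there (sub m)
    back (inj₂ (here refl)) = there (start∈ w)
    back (inj₂ (there (here e))) = here e

  injection-≤ : ∀ {m} (L : List Vert) (f : Fin m → Vert) → (∀ {i j} → f i ≡ f j → i ≡ j) →
                (∀ i → f i ∈ L) → m ≤ length L
  injection-≤ L f inj mem = injective⇒≤ {f = λ i → index (mem i)} λ {i} {j} e →
    inj (trans (lookup-index (mem i)) (trans (cong (lookup L) e) (sym (lookup-index (mem j)))))

  injection-onto : ∀ {m} (L : List Vert) (f : Fin m → Vert) → (∀ {i j} → f i ≡ f j → i ≡ j) →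
                   (∀ i → f i ∈ L) → length L ≤ m → ∀ {c} → c ∈ L → Σ (Fin m) λ i → f i ≡ c
  injection-onto {m} L f inj mem len {c} c∈ with any? (λ i → f i ≟ c)
  ... | yes hit = hit
  ... | no miss = ⊥-elim (1+n≰n (≤-trans (injection-≤ L g g-inj g-mem) len))
    where
    g : Fin (suc m) → Vert
    g zero = c
    g (suc i) = f i
    g-inj : ∀ {i j} → g i ≡ g j → i ≡ j
    g-inj {zero} {zero} e = refl
    g-inj {zero} {suc j} e = ⊥-elim (miss (j , sym e))
    g-inj {suc i} {zero} e = ⊥-elim (miss (i , e))
    g-inj {suc i} {suc j} e = cong suc (inj e)
    g-mem : ∀ i → g i ∈ L
    g-mem zero = c∈
    g-mem (suc i) = mem i

  lookup-injective : ∀ {xs : List Vert} → Unique xs → ∀ {i j} → lookup xs i ≡ lookup xs j → i ≡ j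
  lookup-injective {x ∷ xs} (x∉ ∷ u) {zero} {zero} e = refl
  lookup-injective {x ∷ xs} (x∉ ∷ u) {zero} {suc j} e = ⊥-elim (All.lookup x∉ (∈-lookup j) e)
  lookup-injective {x ∷ xs} (x∉ ∷ u) {suc i} {zero} e = ⊥-elim (All.lookup x∉ (∈-lookup i) (sym e))
  lookup-injective {x ∷ xs} (x∉ ∷ u) {suc i} {suc j} e = cong suc (lookup-injective u e)

  outside : ∀ (M Z : List Vert) → Unique M → length Z < length M → Σ Vert λ m → m ∈ M × m ∉ Z
  outside M Z u lt with All.all? (_∈? Z) M
  ... | yes all∈ = ⊥-elim (<⇒≱ lt (injection-≤ Z (lookup M) (lookup-injective u) (λ i → All.lookup all∈ (∈-lookup i))))
  ... | no ¬all∈ = find (¬All⇒Any¬ (_∈? Z) M ¬all∈)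

  module Delete (S : List Vert) (s : Vert) where
    keep? : (t : Vert) → Dec (t ≢ s)
    keep? t = ¬? (t ≟ s)

    S∖s : List Vert
    S∖s = filter keep? S

    shorter : s ∈ S → length S∖s < length S
    shorter s∈ = filter-notAll keep? S (Data.List.Relation.Unary.Any.map (λ e n → n (sym e)) s∈)

    ⊆S : S∖s ⊆ S
    ⊆S m = proj₁ (∈-filter⁻ keep? {xs = S} m)

    s∉ : s ∉ S∖s
    s∉ m = proj₂ (∈-filter⁻ keep? {xs = S} m) refl

    avoids-S : ∀ {xs} → Avoids S∖s xs → All (_≢ s) xs → Avoids S xs
    avoids-S av ne = All.zipWith (λ (t∉ , t≢s) t∈S → t∉ (∈-filter⁺ keep? t∈S t≢s)) (av , ne)

  PairwiseMeetIn : ∀ {Route : Set} → (Route → List Vert) → List Vert → Route → Route → Set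
  PairwiseMeetIn vs Ends r r' = ∀ {t} → t ∈ vs r → t ∈ vs r' → t ∈ Ends

  route-avoiding : ∀ {Route : Set} (vs : Route → List Vert) (Ends S : List Vert) (rs : List Route) →
                   AllPairs (PairwiseMeetIn vs Ends) rs → Avoids S Ends → length S < length rs →
                   Σ Route λ r → r ∈ rs × Avoids S (vs r)
  route-avoiding {Route} vs Ends S (r ∷ rs) (meet ∷ meets) avEnds lt with All.all? (λ t → ¬? (t ∈? S)) (vs r)
  ... | yes av = r , here refl , av
  ... | no ¬av with find (¬All⇒Any¬ (λ t → ¬? (t ∈? S)) (vs r) ¬av)
  ...   | s , s∈r , ¬s∉S = r' , there r'∈ , All.tabulate avoid
    where
    -- r passes through s ∈ S; the other routes miss s, so recurse on S without s
    open Delete S s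
    s∈S : s ∈ S
    s∈S = decidable-stable (s ∈? S) ¬s∉S
    IH : Σ Route λ r' → r' ∈ rs × Avoids S∖s (vs r')
    IH = route-avoiding vs Ends S∖s rs meets (All.map (_∘ ⊆S) avEnds) (<-≤-trans (shorter s∈S) (≤-pred lt))
    r' : Route
    r' = proj₁ IH
    r'∈ : r' ∈ rs
    r'∈ = proj₁ (proj₂ IH)
    avoid : ∀ {t} → t ∈ vs r' → t ∉ S
    avoid {t} t∈ t∈S with t ≟ s
    ... | yes refl = avoids-∈ avEnds (All.lookup meet r'∈ s∈r t∈) t∈S
    ... | no t≢s = avoids-∈ (proj₂ (proj₂ IH)) t∈ (∈-filter⁺ keep? t∈S t≢s)

-- The proof is the classical induction on the number of edges
-- (Diestel, Graph Theory, first proof of Thm 3.3.1).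
module Menger {Vert : Set} (_≟_ : DecidableEquality Vert) where
  open import Data.Nat using (ℕ; _<_; _≤?_)
  open import Data.Nat.Properties using (≰⇒>)
  open import Data.Fin using (Fin; inject≤)
  import Data.Fin as Fin
  open import Data.Fin.Properties using (inject≤-injective)
  open import Data.List using (List; []; _∷_; length; lookup; filter; deduplicate)
  open import Data.List.Membership.Propositional using (_∈_; _∉_)
  open import Data.List.Membership.Propositional.Properties using (∈-lookup; ∈-filter⁺; ∈-filter⁻; ∈-deduplicate⁺; ∈-deduplicate⁻)
  open import Data.List.Relation.Unary.Unique.DecPropositional.Properties using (deduplicate-!)
  open import Data.List.Relation.Binary.Subset.Propositional using (_⊆_)
  open import Data.List.Relation.Binary.Disjoint.Propositional using (Disjoint)
  open import Data.List.Relation.Unary.Any using (here; there)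
  open import Data.List.Relation.Unary.All using ([]; _∷_)
  open import Data.List.Relation.Unary.All.Properties using (anti-mono)
  open import Data.List.Relation.Unary.AllPairs using ([]; _∷_)
  open import Data.Product using (Σ; _×_; _,_; proj₁; proj₂)
  open import Data.Sum using (_⊎_; inj₁; inj₂; [_,_]′)
  open import Data.Empty using (⊥; ⊥-elim)
  open import Function using (_∘_; id)
  open import Relation.Nullary using (Dec; yes; no; ¬_)
  open import Relation.Nullary.Decidable using (¬?; _×-dec_; _⊎-dec_; map′)
  open import Relation.Binary.PropositionalEquality using (_≡_; _≢_; refl; sym; trans; cong; subst)

  open Walks _≟_
  open import Data.List.Membership.DecPropositional _≟_ using (_∈?_)

  record ABWalk (G : Graph) (A B : List Vert) : Set where
    constructor abw
    field
      {source target} : Vert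
      source∈ : source ∈ A
      target∈ : target ∈ B
      route : Walk G source target

  open ABWalk

  vertsAB : ∀ {G A B} → ABWalk G A B → List Vert
  vertsAB P = verts (route P)

  Separates : Graph → List Vert → List Vert → List Vert → Set
  Separates G A B S = (P : ABWalk G A B) → Avoids S (vertsAB P) → ⊥

  Linkage : Graph → List Vert → List Vert → ℕ → Set
  Linkage G A B k = Σ (Fin k → ABWalk G A B) λ P → ∀ i j → i ≢ j → Disjoint (vertsAB (P i)) (vertsAB (P j))

  MengerAlternative : Graph → List Vert → List Vert → ℕ → Set
  MengerAlternative G A B k = Linkage G A B k ⊎ Σ (List Vert) λ S → length S < k × Separates G A B S

  Reaches : Graph → List Vert → List Vert → Vert → Set
  Reaches G Y A b = Σ Vert λ a → a ∈ A × Σ (Walk G a b) λ w → Avoids Y (verts w)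

  not-reached-from-both : ∀ {G A B Y u} → (∀ {a b} → G a b → G b a) → Separates G A B Y →
                          Reaches G Y A u → Reaches G Y B u → ⊥
  not-reached-from-both symG sep (a , a∈ , w₁ , av₁) (b , b∈ , w₂ , av₂) =
    let (w₂' , sub) = reverseW symG w₂
    in sep (abw a∈ b∈ (w₁ ++w w₂')) (++w-avoids w₁ w₂' av₁ (anti-mono sub av₂))

  record OneEdgeMore (G G' : Graph) (x y : Vert) : Set where
    field
      lift  : ∀ {a b} → G' a b → G a b
      new   : G x y
      symG  : ∀ {a b} → G a b → G b a
      symG' : ∀ {a b} → G' a b → G' b a
      split : ∀ {a b} → G a b → G' a b ⊎ ((a ≡ x × b ≡ y) ⊎ (a ≡ y × b ≡ x))

  flipEdge : ∀ {G G' x y} → OneEdgeMore G G' x y → OneEdgeMore G G' y x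
  flipEdge {G} {G'} {x} {y} ext = record { lift = lift ; new = symG new ; symG = symG ; symG' = symG' ; split = split' }
    where
    open OneEdgeMore ext
    split' : ∀ {a b} → G a b → G' a b ⊎ ((a ≡ y × b ≡ x) ⊎ (a ≡ x × b ≡ y))
    split' r with split r
    ... | inj₁ r' = inj₁ r'
    ... | inj₂ (inj₁ e) = inj₂ (inj₂ e)
    ... | inj₂ (inj₂ e) = inj₂ (inj₁ e)

  module Decompose {G G' x y} (ext : OneEdgeMore G G' x y) where
    open OneEdgeMore ext public

    IsEnd : Vert → Set
    IsEnd u = u ≡ x ⊎ u ≡ y

    InOld : ∀ {a b} → Walk G a b → Set
    InOld {a} {b} w = Σ (Walk G' a b) λ w' → verts w' ⊆ verts w

    liftW : ∀ {a b} → Walk G' a b → Walk G a b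
    liftW = mapW lift

    ∈-liftW : ∀ {a b t} (w : Walk G' a b) → t ∈ verts (liftW w) → t ∈ verts w
    ∈-liftW {t = t} w = subst (t ∈_) (mapW-verts lift w)

    avoids-liftW : ∀ {S a b} (w : Walk G' a b) → Avoids S (verts w) → Avoids S (verts (liftW w))
    avoids-liftW {S} w = subst (Avoids S) (sym (mapW-verts lift w))

    firstUse : ∀ {a b} (w : Walk G a b) → InOld w ⊎ Σ Vert λ u → IsEnd u × Σ (Walk G' a u) λ w' → verts w' ⊆ initV w
    firstUse [ a ] = inj₁ ([ a ] , id)
    firstUse (a ∷⟨ r ⟩ w) with split r
    ... | inj₂ (inj₁ (refl , _)) = inj₂ (a , inj₁ refl , [ a ] , λ { (here e) → here e })
    ... | inj₂ (inj₂ (refl , _)) = inj₂ (a , inj₂ refl , [ a ] , λ { (here e) → here e })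
    ... | inj₁ r' with firstUse w
    ...   | inj₁ (w' , sub) = inj₁ ((a ∷⟨ r' ⟩ w') , λ { (here e) → here e ; (there q) → there (sub q) })
    ...   | inj₂ (u , u-end , w' , sub) =
            inj₂ (u , u-end , (a ∷⟨ r' ⟩ w') , λ { (here e) → here e ; (there q) → there (sub q) })

    lastUse : ∀ {a b} (w : Walk G a b) → InOld w ⊎ Σ Vert λ v → IsEnd v × Σ (Walk G' v b) λ w' → verts w' ⊆ tailV w
    lastUse [ a ] = inj₁ ([ a ] , id)
    lastUse (a ∷⟨ r ⟩ w) with lastUse w
    ... | inj₂ (v , v-end , w' , sub) = inj₂ (v , v-end , w' , tail⊆ w ∘ sub)
    ... | inj₁ (w' , sub) with split r
    ...   | inj₁ r' = inj₁ ((a ∷⟨ r' ⟩ w') , λ { (here e) → here e ; (there q) → there (sub q) })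
    ...   | inj₂ (inj₁ (_ , refl)) = inj₂ (y , inj₂ refl , w' , sub)
    ...   | inj₂ (inj₂ (_ , refl)) = inj₂ (x , inj₁ refl , w' , sub)

    missing-end : ∀ {a b} (w : Walk G a b) → (x ∉ verts w ⊎ y ∉ verts w) → InOld w
    missing-end [ a ] _ = [ a ] , id
    missing-end (a ∷⟨ r ⟩ w) miss with split r
    ... | inj₁ r' = let (w' , sub) = missing-end w (Data.Sum.map (_∘ there) (_∘ there) miss)
                    in (a ∷⟨ r' ⟩ w') , λ { (here e) → here e ; (there q) → there (sub q) }
    missing-end (a ∷⟨ r ⟩ w) (inj₁ x∉) | inj₂ (inj₁ (refl , _)) = ⊥-elim (x∉ (here refl))
    missing-end (a ∷⟨ r ⟩ w) (inj₂ y∉) | inj₂ (inj₁ (_ , refl)) = ⊥-elim (y∉ (there (start∈ w)))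
    missing-end (a ∷⟨ r ⟩ w) (inj₁ x∉) | inj₂ (inj₂ (_ , refl)) = ⊥-elim (x∉ (there (start∈ w)))
    missing-end (a ∷⟨ r ⟩ w) (inj₂ y∉) | inj₂ (inj₂ (refl , _)) = ⊥-elim (y∉ (here refl))

    hop : ∀ {u v} → IsEnd u → IsEnd v → Σ (Walk G u v) λ h → verts h ⊆ u ∷ v ∷ []
    hop (inj₁ refl) (inj₁ refl) = [ x ] , λ { (here e) → here e }
    hop (inj₂ refl) (inj₂ refl) = [ y ] , λ { (here e) → here e }
    hop (inj₁ refl) (inj₂ refl) = (x ∷⟨ new ⟩ [ y ]) , id
    hop (inj₂ refl) (inj₁ refl) = (y ∷⟨ symG new ⟩ [ x ]) , id

    via-new-edge : ∀ {Y A u v b} → IsEnd u → Reaches G' Y A u → IsEnd v → (w : Walk G' v b) →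
                   Avoids Y (verts w) → Reaches G Y A b
    via-new-edge u-end (a , a∈ , w₁ , av₁) v-end w av with hop u-end v-end
    ... | h , sub = a , a∈ , (liftW w₁ ++w (h ++w liftW w)) ,
      ++w-avoids (liftW w₁) _ (avoids-liftW w₁ av₁)
        (++w-avoids h (liftW w) (anti-mono sub (avoids-∈ av₁ (end∈ w₁) ∷ avoids-∈ av (start∈ w) ∷ []))
                                (avoids-liftW w av))

  module EdgeLists where
    Edges : Set
    Edges = List (Vert × Vert)

    Adjacent : Edges → Graph
    Adjacent E a b = (a , b) ∈ E ⊎ (b , a) ∈ E

    adjacent-sym : ∀ {E a b} → Adjacent E a b → Adjacent E b a
    adjacent-sym (inj₁ m) = inj₂ m
    adjacent-sym (inj₂ m) = inj₁ m

    cons-edge : ∀ x y E → OneEdgeMore (Adjacent ((x , y) ∷ E)) (Adjacent E) x y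
    cons-edge x y E = record
      { lift = Data.Sum.map there there
      ; new = inj₁ (here refl)
      ; symG = adjacent-sym
      ; symG' = adjacent-sym
      ; split = λ { (inj₁ (here refl)) → inj₂ (inj₁ (refl , refl)) ; (inj₁ (there m)) → inj₁ (inj₁ m)
                  ; (inj₂ (here refl)) → inj₂ (inj₂ (refl , refl)) ; (inj₂ (there m)) → inj₁ (inj₂ m) } }

    trivial-walk : ∀ {a b} → Walk (Adjacent []) a b → a ≡ b
    trivial-walk [ a ] = refl
    trivial-walk (a ∷⟨ inj₁ () ⟩ w)
    trivial-walk (a ∷⟨ inj₂ () ⟩ w)

    reaches? : ∀ E Y A b → Dec (Reaches (Adjacent E) Y A b)
    reaches? [] Y A b = map′ (λ (b∈ , b∉) → b , b∈ , [ b ] , b∉ ∷ []) complete (b ∈? A ×-dec ¬? (b ∈? Y))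
      where
      complete : Reaches (Adjacent []) Y A b → b ∈ A × b ∉ Y
      complete (a , a∈ , w , av) with trivial-walk w
      ... | refl = a∈ , avoids-∈ av (start∈ w)
    reaches? ((x , y) ∷ E) Y A b with reaches? E Y A x ⊎-dec reaches? E Y A y
    ... | yes r = map′ sound complete (reaches? E Y (x ∷ y ∷ A) b)
      where
      -- A reaches an end of the new edge, so reaching from A is reaching from A, x, y in E
      open Decompose (cons-edge x y E)
      reached-end : Σ Vert λ u → IsEnd u × Reaches (Adjacent E) Y A u
      reached-end = [ (λ rx → x , inj₁ refl , rx) , (λ ry → y , inj₂ refl , ry) ]′ r
      sound : Reaches (Adjacent E) Y (x ∷ y ∷ A) b → Reaches (Adjacent ((x , y) ∷ E)) Y A b
      sound (s , here refl , w , av) = via-new-edge (proj₁ (proj₂ reached-end)) (proj₂ (proj₂ reached-end)) (inj₁ refl) w av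
      sound (s , there (here refl) , w , av) = via-new-edge (proj₁ (proj₂ reached-end)) (proj₂ (proj₂ reached-end)) (inj₂ refl) w av
      sound (s , there (there s∈) , w , av) = s , s∈ , liftW w , avoids-liftW w av
      complete : Reaches (Adjacent ((x , y) ∷ E)) Y A b → Reaches (Adjacent E) Y (x ∷ y ∷ A) b
      complete (a , a∈ , w , av) with lastUse w
      ... | inj₁ (w' , sub) = a , there (there a∈) , w' , anti-mono sub av
      ... | inj₂ (v , inj₁ refl , w' , sub) = x , here refl , w' , anti-mono (tail⊆ w ∘ sub) av
      ... | inj₂ (v , inj₂ refl , w' , sub) = y , there (here refl) , w' , anti-mono (tail⊆ w ∘ sub) av
    ... | no ¬r = map′ sound complete (reaches? E Y A b)
      where
      -- A reaches neither end of the new edge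
      open Decompose (cons-edge x y E)
      sound : Reaches (Adjacent E) Y A b → Reaches (Adjacent ((x , y) ∷ E)) Y A b
      sound (a , a∈ , w , av) = a , a∈ , liftW w , avoids-liftW w av
      complete : Reaches (Adjacent ((x , y) ∷ E)) Y A b → Reaches (Adjacent E) Y A b
      complete (a , a∈ , w , av) with firstUse w
      ... | inj₁ (w' , sub) = a , a∈ , w' , anti-mono sub av
      ... | inj₂ (u , inj₁ refl , w' , sub) = ⊥-elim (¬r (inj₁ (a , a∈ , w' , anti-mono (init⊆ w ∘ sub) av)))
      ... | inj₂ (u , inj₂ refl , w' , sub) = ⊥-elim (¬r (inj₂ (a , a∈ , w' , anti-mono (init⊆ w ∘ sub) av)))

  linkage-meet : ∀ {G A B k} (L : Linkage G A B k) {i j t} →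
                 t ∈ vertsAB (proj₁ L i) → t ∈ vertsAB (proj₁ L j) → i ≡ j
  linkage-meet (P , disjoint) {i} {j} ti tj with i Fin.≟ j
  ... | yes e = e
  ... | no i≢j = ⊥-elim (disjoint i j i≢j (ti , tj))

  -- Then X = x ∷ Y and X' = y ∷ Y separate A from B in G;
  -- a small A–X or X'–B separator in G' separates A from B in G, and otherwise k disjoint
  -- A–X walks and k disjoint X'–B walks in G' combine, through the new edge, into k
  -- disjoint A–B walks in G.
  module Augment {G G' x y} (ext : OneEdgeMore G G' x y) (IH : ∀ A B k → MengerAlternative G' A B k)
    {A B : List Vert} {k : ℕ} {Y : List Vert} (|Y|<k : length Y < k) (sepY : Separates G' A B Y)
    (rx : Reaches G' Y A x) (qy : Reaches G' Y B y) where

    open Decompose ext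

    ¬ry : ¬ Reaches G' Y A y
    ¬ry ry = not-reached-from-both symG' sepY ry qy

    ¬qx : ¬ Reaches G' Y B x
    ¬qx qx = not-reached-from-both symG' sepY rx qx

    X X' : List Vert
    X = x ∷ Y
    X' = y ∷ Y

    y∉Y : y ∉ Y
    y∉Y = let (_ , _ , w , av) = qy in avoids-∈ av (end∈ w)

    x≢y : x ≢ y
    x≢y refl = ¬ry rx

    -- a walk avoiding X (or X') misses x (resp. y), so it lies in G' and meets Y
    separatesX : Separates G A B X
    separatesX (abw a∈ b∈ w) av =
      let (w' , sub) = missing-end w (inj₁ λ m → avoids-∈ av m (here refl))
      in sepY (abw a∈ b∈ w') (anti-mono sub (avoids-tail av))

    separatesX' : Separates G A B X'
    separatesX' (abw a∈ b∈ w) av =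
      let (w' , sub) = missing-end w (inj₂ λ m → avoids-∈ av m (here refl))
      in sepY (abw a∈ b∈ w') (anti-mono sub (avoids-tail av))

    -- an A–B walk in G runs through X; its part up to X lies in G', since reaching
    -- y avoiding Y is impossible and x is in X
    from-A-side : ∀ Z → Separates G' A X Z → Separates G A B Z
    from-A-side Z sepZ (abw {a} a∈ b∈ w) avZ with firstHit X w
    ... | inj₁ avX = separatesX (abw a∈ b∈ w) avX
    ... | inj₂ (c , c∈ , w₁ , avI , sub) with firstUse w₁
    ...   | inj₁ (w₁' , sub') = sepZ (abw a∈ c∈ w₁') (anti-mono (sub ∘ sub') avZ)
    ...   | inj₂ (u , inj₁ refl , w' , sub') = avoids-∈ avI (sub' (end∈ w')) (here refl)
    ...   | inj₂ (u , inj₂ refl , w' , sub') = ¬ry (a , a∈ , w' , avoids-tail (anti-mono sub' avI))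

    -- symmetrically, its part from the last vertex in X' lies in G'
    from-B-side : ∀ Z → Separates G' X' B Z → Separates G A B Z
    from-B-side Z sepZ (abw {target = b} a∈ b∈ w) avZ with lastHit X' w
    ... | inj₁ avX = separatesX' (abw a∈ b∈ w) avX
    ... | inj₂ (d , d∈ , w₂ , avT , sub) with lastUse w₂
    ...   | inj₁ (w₂' , sub') = sepZ (abw d∈ b∈ w₂') (anti-mono (sub ∘ sub') avZ)
    ...   | inj₂ (v , inj₂ refl , w' , sub') = avoids-∈ avT (sub' (start∈ w')) (here refl)
    ...   | inj₂ (v , inj₁ refl , w' , sub') =
            let (w'' , sub'') = reverseW symG' w'
            in ¬qx (b , b∈ , w'' , anti-mono sub'' (avoids-tail (anti-mono sub' avT)))

    partner : Vert → Vert
    partner c with c ≟ x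
    ... | yes _ = y
    ... | no _ = c

    partner-cases : ∀ c → (c ≡ x × partner c ≡ y) ⊎ (c ≢ x × partner c ≡ c)
    partner-cases c with c ≟ x
    ... | yes e = inj₁ (e , refl)
    ... | no n = inj₂ (n , refl)

    partner∈ : ∀ {c} → c ∈ X → partner c ∈ X'
    partner∈ {c} c∈ with partner-cases c | c∈
    ... | inj₁ (_ , e) | _ = subst (_∈ X') (sym e) (here refl)
    ... | inj₂ (c≢x , e) | here c≡x = ⊥-elim (c≢x c≡x)
    ... | inj₂ (_ , e) | there c∈Y = subst (_∈ X') (sym e) (there c∈Y)

    partner-fixes : ∀ {c c'} → c ∈ X → c ≡ partner c' → c ≡ c'
    partner-fixes {c} {c'} c∈ e with partner-cases c'
    ... | inj₂ (_ , e') = trans e e'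
    ... | inj₁ (_ , e') with trans e e' | c∈
    ...   | refl | here e'' = ⊥-elim (x≢y (sym e''))
    ...   | refl | there c∈Y = ⊥-elim (y∉Y c∈Y)

    partner-injective : ∀ {c c'} → c ∈ X → c' ∈ X → partner c ≡ partner c' → c ≡ c'
    partner-injective {c} {c'} c∈ c'∈ e with partner-cases c | partner-cases c'
    ... | inj₁ (c≡x , _) | inj₁ (c'≡x , _) = trans c≡x (sym c'≡x)
    ... | inj₂ (_ , e') | _ = partner-fixes c∈ (trans (sym e') e)
    ... | inj₁ _ | inj₂ (_ , e'') = sym (partner-fixes c'∈ (trans (sym e'') (sym e)))

    Joinable : Vert → Vert → Set
    Joinable c d = (c ≡ x × d ≡ y) ⊎ c ≡ d

    joinable : ∀ {c d} → d ≡ partner c → Joinable c d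
    joinable {c} e with partner-cases c
    ... | inj₁ (c≡x , e') = inj₁ (c≡x , trans e e')
    ... | inj₂ (_ , e') = inj₂ (sym (trans e e'))

    join : ∀ {a c d b} → Walk G' a c → Walk G' d b → Joinable c d → Walk G a b
    join w₁ w₂ (inj₁ (refl , refl)) = liftW w₁ ++w (x ∷⟨ new ⟩ liftW w₂)
    join w₁ w₂ (inj₂ refl) = liftW w₁ ++w liftW w₂

    ∈-join : ∀ {a c d b t} (w₁ : Walk G' a c) (w₂ : Walk G' d b) (j : Joinable c d) →
             t ∈ verts (join w₁ w₂ j) → t ∈ verts w₁ ⊎ t ∈ verts w₂
    ∈-join w₁ w₂ (inj₁ (refl , refl)) m with ++w-∈ (liftW w₁) _ m
    ... | inj₁ q = inj₁ (∈-liftW w₁ q)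
    ... | inj₂ (here refl) = inj₁ (end∈ w₁)
    ... | inj₂ (there q) = inj₂ (∈-liftW w₂ q)
    ∈-join w₁ w₂ (inj₂ refl) m with ++w-∈ (liftW w₁) _ m
    ... | inj₁ q = inj₁ (∈-liftW w₁ q)
    ... | inj₂ q = inj₂ (∈-liftW w₂ q)

    module Combine (L : Linkage G' A X k) (L' : Linkage G' X' B k) where
      P : Fin k → ABWalk G' A X
      P = proj₁ L
      Q : Fin k → ABWalk G' X' B
      Q = proj₁ L'

      cutP : ∀ i → FirstHit X (route (P i))
      cutP i with firstHit X (route (P i))
      ... | inj₁ av = ⊥-elim (avoids-∈ av (end∈ (route (P i))) (target∈ (P i)))
      ... | inj₂ h = h

      cutQ : ∀ j → LastHit X' (route (Q j))
      cutQ j with lastHit X' (route (Q j))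
      ... | inj₁ av = ⊥-elim (avoids-∈ av (start∈ (route (Q j))) (source∈ (Q j)))
      ... | inj₂ h = h

      c : Fin k → Vert
      c i = proj₁ (cutP i)
      c∈ : ∀ i → c i ∈ X
      c∈ i = proj₁ (proj₂ (cutP i))
      front : ∀ i → Walk G' (source (P i)) (c i)
      front i = proj₁ (proj₂ (proj₂ (cutP i)))
      frontAvoids : ∀ i → Avoids X (initV (front i))
      frontAvoids i = proj₁ (proj₂ (proj₂ (proj₂ (cutP i))))
      frontInP : ∀ i → verts (front i) ⊆ vertsAB (P i)
      frontInP i = proj₂ (proj₂ (proj₂ (proj₂ (cutP i))))

      d : Fin k → Vert
      d j = proj₁ (cutQ j)
      d∈ : ∀ j → d j ∈ X'
      d∈ j = proj₁ (proj₂ (cutQ j))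
      back : ∀ j → Walk G' (d j) (target (Q j))
      back j = proj₁ (proj₂ (proj₂ (cutQ j)))
      backAvoids : ∀ j → Avoids X' (tailV (back j))
      backAvoids j = proj₁ (proj₂ (proj₂ (proj₂ (cutQ j))))
      backInQ : ∀ j → verts (back j) ⊆ vertsAB (Q j)
      backInQ j = proj₂ (proj₂ (proj₂ (proj₂ (cutQ j))))

      c-injective : ∀ {i i'} → c i ≡ c i' → i ≡ i'
      c-injective {i} {i'} e =
        linkage-meet L (frontInP i (end∈ (front i))) (frontInP i' (subst (_∈ verts (front i')) (sym e) (end∈ (front i'))))

      d-injective : ∀ {j j'} → d j ≡ d j' → j ≡ j'
      d-injective {j} {j'} e =
        linkage-meet L' (backInQ j (start∈ (back j))) (backInQ j' (subst (_∈ verts (back j')) (sym e) (start∈ (back j'))))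

      -- the k distinct starts d j fill X' (as |X'| ≤ k), so each c i has a matching back
      match : ∀ i → Σ (Fin k) λ j → d j ≡ partner (c i)
      match i = injection-onto X' d d-injective d∈ |Y|<k (partner∈ (c∈ i))

      σ : Fin k → Fin k
      σ i = proj₁ (match i)

      joins : ∀ i → Joinable (c i) (d (σ i))
      joins i = joinable (proj₂ (match i))

      combined : Fin k → ABWalk G A B
      combined i = abw (source∈ (P i)) (target∈ (Q (σ i))) (join (front i) (back (σ i)) (joins i))

      -- a front and a back can only meet in their common end: an inner meeting point
      -- would give an A–B walk avoiding Y, and an end meeting the inside of the other
      -- walk would let A reach y, or x reach B, avoiding Y
      front-back-meet : ∀ i j {t} → t ∈ verts (front i) → t ∈ verts (back j) → c i ≡ d j
      front-back-meet i j t∈h t∈t with init-or-end (front i) t∈h | start-or-tail (back j) t∈t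
      ... | inj₂ refl | inj₁ e = e
      ... | inj₁ inner | inj₂ inner' =
            let (w₁ , sub₁) = prefixTo (front i) inner
                (w₂ , sub₂) = suffixFrom (back j) inner'
            in ⊥-elim (sepY (abw (source∈ (P i)) (target∈ (Q j)) (w₁ ++w w₂))
                 (++w-avoids w₁ w₂ (avoids-tail (anti-mono sub₁ (frontAvoids i))) (avoids-tail (anti-mono sub₂ (backAvoids j)))))
      ... | inj₂ refl | inj₂ inner' with c∈ i
      ...   | there c∈Y = ⊥-elim (avoids-∈ (backAvoids j) inner' (there c∈Y))
      ...   | here c≡x =
              let (w₂ , sub₂) = suffixFrom (back j) inner'
                  (w₂' , sub₂') = reverseW symG' w₂
              in ⊥-elim (¬qx (subst (Reaches G' Y B) c≡x
                   (_ , target∈ (Q j) , w₂' , anti-mono sub₂' (avoids-tail (anti-mono sub₂ (backAvoids j))))))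
      front-back-meet i j t∈h t∈t | inj₁ inner | inj₁ refl with d∈ j
      ...   | there d∈Y = ⊥-elim (avoids-∈ (frontAvoids i) inner (there d∈Y))
      ...   | here d≡y =
              let (w₁ , sub₁) = prefixTo (front i) inner
              in ⊥-elim (¬ry (subst (Reaches G' Y A) d≡y
                   (_ , source∈ (P i) , w₁ , avoids-tail (anti-mono sub₁ (frontAvoids i)))))

      -- fronts are disjoint, backs are disjoint, and a front meets a back only where
      -- they are joined
      combined-disjoint : ∀ i i' → i ≢ i' → Disjoint (vertsAB (combined i)) (vertsAB (combined i'))
      combined-disjoint i i' i≢i' (t∈ , t∈') with ∈-join (front i) (back (σ i)) (joins i) t∈ | ∈-join (front i') (back (σ i')) (joins i') t∈'
      ... | inj₁ h | inj₁ h' = proj₂ L i i' i≢i' (frontInP i h , frontInP i' h')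
      ... | inj₁ h | inj₂ t' = i≢i' (c-injective (partner-fixes (c∈ i) (trans (front-back-meet i (σ i') h t') (proj₂ (match i')))))
      ... | inj₂ t | inj₁ h' = i≢i' (sym (c-injective (partner-fixes (c∈ i') (trans (front-back-meet i' (σ i) h' t) (proj₂ (match i))))))
      ... | inj₂ t | inj₂ t' with σ i Fin.≟ σ i'
      ...   | no σ≢ = proj₂ L' (σ i) (σ i') σ≢ (backInQ (σ i) t , backInQ (σ i') t')
      ...   | yes σ≡ = i≢i' (c-injective (partner-injective (c∈ i) (c∈ i')
                          (trans (sym (proj₂ (match i))) (trans (cong d σ≡) (proj₂ (match i'))))))

      linkage : Linkage G A B k
      linkage = combined , combined-disjoint

    result : MengerAlternative G A B k
    result with IH A X k
    ... | inj₂ (Z , lt , sepZ) = inj₂ (Z , lt , from-A-side Z sepZ)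
    ... | inj₁ L with IH X' B k
    ...   | inj₂ (Z , lt , sepZ) = inj₂ (Z , lt , from-B-side Z sepZ)
    ...   | inj₁ L' = inj₁ (Combine.linkage L L')

  open EdgeLists

  module NoEdges (A B : List Vert) where
    common : List Vert
    common = deduplicate _≟_ (filter (_∈? B) A)

    common⁻ : ∀ {t} → t ∈ common → t ∈ A × t ∈ B
    common⁻ m = ∈-filter⁻ (_∈? B) (∈-deduplicate⁻ _≟_ _ m)

    common⁺ : ∀ {t} → t ∈ A → t ∈ B → t ∈ common
    common⁺ t∈A t∈B = ∈-deduplicate⁺ _≟_ (∈-filter⁺ (_∈? B) t∈A t∈B)

    result : ∀ k → MengerAlternative (Adjacent []) A B k
    result k with k ≤? length common
    ... | yes k≤ = inj₁ (single , disjoint)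
      where
      pick : Fin k → Vert
      pick i = lookup common (inject≤ i k≤)
      single : Fin k → ABWalk (Adjacent []) A B
      single i = let (t∈A , t∈B) = common⁻ (∈-lookup (inject≤ i k≤)) in abw t∈A t∈B [ pick i ]
      disjoint : ∀ i j → i ≢ j → Disjoint (vertsAB (single i)) (vertsAB (single j))
      disjoint i j i≢j (here e , here e') =
        i≢j (inject≤-injective k≤ k≤ i j (lookup-injective (deduplicate-! _≟_ (filter (_∈? B) A)) (trans (sym e) e')))
    ... | no k≰ = inj₂ (common , ≰⇒> k≰ , separates)
      where
      separates : Separates (Adjacent []) A B common
      separates (abw a∈ b∈ w) av with trivial-walk w
      ... | refl = avoids-∈ av (start∈ w) (common⁺ a∈ b∈)

  -- Adding an edge xy to a graph with a separator Y (|Y| < k): if A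
  -- reaches x and B reaches y avoiding Y (or the reverse), augment; otherwise Y still
  -- separates, since a walk avoiding Y would have to cross the new edge.
  menger : ∀ E A B k → MengerAlternative (Adjacent E) A B k
  menger [] A B k = NoEdges.result A B k
  menger ((x , y) ∷ E) A B k with menger E A B k
  ... | inj₁ (P , disjoint) =
        inj₁ (liftAB ∘ P , λ i j i≢j (t∈ , t∈') → disjoint i j i≢j (∈-liftW (route (P i)) t∈ , ∈-liftW (route (P j)) t∈'))
    where
    open Decompose (cons-edge x y E)
    liftAB : ABWalk (Adjacent E) A B → ABWalk (Adjacent ((x , y) ∷ E)) A B
    liftAB (abw a∈ b∈ w) = abw a∈ b∈ (liftW w)
  ... | inj₂ (Y , |Y|<k , sepY) with reaches? E Y A x ×-dec reaches? E Y B y | reaches? E Y A y ×-dec reaches? E Y B x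
  ...   | yes (rx , qy) | _ = Augment.result (cons-edge x y E) (menger E) |Y|<k sepY rx qy
  ...   | no _ | yes (ry , qx) = Augment.result (flipEdge (cons-edge x y E)) (menger E) |Y|<k sepY ry qx
  ...   | no ¬xy | no ¬yx = inj₂ (Y , |Y|<k , separates)
    where
    -- a walk avoiding Y must use the new edge, entering it from A's side at one end and
    -- leaving towards B at an end; every combination is excluded
    open Decompose (cons-edge x y E)
    separates : Separates (Adjacent ((x , y) ∷ E)) A B Y
    separates (abw {a} {b} a∈ b∈ w) av with firstUse w | lastUse w
    ... | inj₁ (w' , sub) | _ = sepY (abw a∈ b∈ w') (anti-mono sub av)
    ... | inj₂ _ | inj₁ (w' , sub) = sepY (abw a∈ b∈ w') (anti-mono sub av)
    ... | inj₂ (u , u-end , w₁ , sub₁) | inj₂ (v , v-end , w₂ , sub₂) =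
          let (w₂' , sub₂') = reverseW adjacent-sym w₂
          in excluded u-end v-end (a , a∈ , w₁ , anti-mono (init⊆ w ∘ sub₁) av)
                                  (b , b∈ , w₂' , anti-mono (tail⊆ w ∘ sub₂ ∘ sub₂') av)
      where
      excluded : ∀ {u v} → IsEnd u → IsEnd v → Reaches (Adjacent E) Y A u → Reaches (Adjacent E) Y B v → ⊥
      excluded (inj₁ refl) (inj₁ refl) r q = not-reached-from-both adjacent-sym sepY r q
      excluded (inj₂ refl) (inj₂ refl) r q = not-reached-from-both adjacent-sym sepY r q
      excluded (inj₁ refl) (inj₂ refl) r q = ¬xy (r , q)
      excluded (inj₂ refl) (inj₁ refl) r q = ¬yx (r , q)

-- In both cases a small
-- separator is impossible: it misses a vertex of each end set, and the connectivity
-- path between those vertices would avoid it.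
module FromConnectivity {Vert : Set} (_≟_ : DecidableEquality Vert)
  (vertices : List Vert) (all-vertices : ∀ v → v ∈ vertices)
  (Adj : Vert → Vert → Set) (Adj? : ∀ a b → Dec (Adj a b)) (Adj-sym : ∀ {a b} → Adj a b → Adj b a)
  where
  open import Data.Nat using (ℕ; suc; _≤_; _<_)
  open import Data.Nat.Properties using (≤-refl; ≤-trans; ≤-pred)
  open import Data.Fin using (Fin)
  import Data.Fin as Fin
  open import Data.List using (List; []; _∷_; length; lookup; filter; cartesianProduct)
  open import Data.List.Properties using (length-filter)
  open import Data.List.Membership.Propositional using (_∈_; _∉_)
  open import Data.List.Membership.Propositional.Properties using (∈-lookup; ∈-filter⁺; ∈-filter⁻; ∈-cartesianProduct⁺)
  open import Data.List.Relation.Binary.Subset.Propositional using (_⊆_)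
  open import Data.List.Relation.Unary.Any using (here; there; index)
  open import Data.List.Relation.Unary.Any.Properties using (lookup-index)
  open import Data.List.Relation.Unary.All using (All; []; _∷_)
  import Data.List.Relation.Unary.All as All
  open import Data.List.Relation.Unary.AllPairs using ([]; _∷_)
  open import Data.List.Relation.Unary.Linked using ([-])
  open import Data.List.Relation.Unary.Unique.Propositional using (Unique)
  import Data.List.Relation.Unary.Unique.Propositional.Properties as Unique
  open import Data.Product using (Σ; _×_; _,_; proj₁; proj₂)
  open import Data.Sum using (_⊎_; inj₁; inj₂)
  open import Data.Empty using (⊥; ⊥-elim)
  open import Function using (_∘_)
  open import Relation.Nullary using (yes; no)
  open import Relation.Nullary.Decidable using (¬?; _×-dec_)
  open import Relation.Binary.PropositionalEquality using (_≡_; _≢_; refl; sym; trans; cong; subst)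

  open Walks _≟_
  open Menger _≟_
  open EdgeLists
  open import Data.List.Membership.DecPropositional _≟_ using (_∈?_)

  Connected : ℕ → Set
  Connected k = (S : List Vert) → length S ≤ k → (x y : Vert) → x ∉ S → y ∉ S →
                Σ (List Vert) λ P → IsPathIn Adj x y P × All (λ t → t ∉ S) P

  FanFrom : Vert → List Vert → Set
  FanFrom x M = Σ (Fin (length M) → List Vert) λ P →
    ((i : Fin (length M)) → IsPathIn Adj x (lookup M i) (P i)) ×
    ((i j : Fin (length M)) → i ≢ j → (t : Vert) → t ∈ P i → t ∈ P j → t ≡ x)

  DisjointPathsBetween : List Vert → List Vert → Set
  DisjointPathsBetween M₁ M₂ =
    Σ (Fin (length M₁) → Fin (length M₂)) λ σ →
    Σ (Fin (length M₁) → List Vert) λ P →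
    ((i : Fin (length M₁)) → IsPathIn Adj (lookup M₁ i) (lookup M₂ (σ i)) (P i)) ×
    ((i j : Fin (length M₁)) → i ≢ j → (t : Vert) → t ∈ P i → t ∉ P j)

  edgesAvoiding : List Vert → Edges
  edgesAvoiding X = filter (λ (a , b) → Adj? a b ×-dec ¬? (a ∈? X) ×-dec ¬? (b ∈? X))
                           (cartesianProduct vertices vertices)

  edge∈ : ∀ {X a b} → Adj a b → a ∉ X → b ∉ X → Adjacent (edgesAvoiding X) a b
  edge∈ {a = a} {b} r a∉ b∉ =
    inj₁ (∈-filter⁺ _ (∈-cartesianProduct⁺ (all-vertices a) (all-vertices b)) (r , a∉ , b∉))

  edge∈⁻ : ∀ {X a b} → Adjacent (edgesAvoiding X) a b → Adj a b × a ∉ X × b ∉ X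
  edge∈⁻ (inj₁ m) = proj₂ (∈-filter⁻ _ {xs = cartesianProduct vertices vertices} m)
  edge∈⁻ (inj₂ m) = let (r , b∉ , a∉) = proj₂ (∈-filter⁻ _ {xs = cartesianProduct vertices vertices} m)
                    in Adj-sym r , a∉ , b∉

  toAvoiding : ∀ {X a b} (w : Walk Adj a b) → Avoids X (verts w) → Σ (Walk (Adjacent (edgesAvoiding X)) a b) λ w' → verts w' ≡ verts w
  toAvoiding [ a ] _ = [ a ] , refl
  toAvoiding (a ∷⟨ r ⟩ w) (a∉ ∷ av) with toAvoiding w av
  ... | w' , e = (a ∷⟨ edge∈ r a∉ (avoids-∈ av (start∈ w)) ⟩ w') , cong (a ∷_) e

  fromAvoiding : ∀ {X a b} → Adjacent (edgesAvoiding X) a b → Adj a b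
  fromAvoiding = proj₁ ∘ edge∈⁻

  avoiding-avoids : ∀ {X a b} (w : Walk (Adjacent (edgesAvoiding X)) a b) → a ∉ X → Avoids X (verts w)
  avoiding-avoids [ a ] a∉ = a∉ ∷ []
  avoiding-avoids (a ∷⟨ r ⟩ w) a∉ = a∉ ∷ avoiding-avoids w (proj₂ (proj₂ (edge∈⁻ r)))

  pathAlong : ∀ {X a b a' b'} (w : Walk (Adjacent (edgesAvoiding X)) a b) → a ≡ a' → b ≡ b' →
              Σ (List Vert) λ P → IsPathIn Adj a' b' P × P ⊆ verts w
  pathAlong w refl refl with pathIn (mapW fromAvoiding w)
  ... | P , isPath , sub = P , isPath , λ {t} m → subst (t ∈_) (mapW-verts fromAvoiding w) (sub m)

  module _ (k : ℕ) (connected : Connected k) where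

    separator-too-small : ∀ {A B} Z → length Z ≤ k → ∀ {a b} → a ∈ A → b ∈ B → a ∉ Z → b ∉ Z →
                          Separates (Adjacent (edgesAvoiding [])) A B Z → ⊥
    separator-too-small Z |Z|≤k a∈ b∈ a∉ b∉ sep =
      let (P , isPath , av) = connected Z |Z|≤k _ _ a∉ b∉
          (w , e) = path→walk P isPath
          (w' , e') = toAvoiding {X = []} w (All.tabulate λ _ ())
      in sep (abw a∈ b∈ w') (subst (Avoids Z) (sym (trans e' e)) av)

    linkage : (M₁ M₂ : List Vert) → Unique M₁ → Unique M₂ → length M₁ ≡ length M₂ → length M₁ ≤ suc k →
              DisjointPathsBetween M₁ M₂
    linkage M₁ M₂ u₁ u₂ same-length small with menger (edgesAvoiding []) M₁ M₂ (length M₁)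
    ... | inj₂ (Z , |Z|< , sep) =
          let (m₁ , m₁∈ , m₁∉) = outside M₁ Z u₁ |Z|<
              (m₂ , m₂∈ , m₂∉) = outside M₂ Z u₂ (subst (length Z <_) same-length |Z|<)
          in ⊥-elim (separator-too-small Z (≤-pred (≤-trans |Z|< small)) m₁∈ m₂∈ m₁∉ m₂∉ sep)
    ... | inj₁ L = σ , (λ i → proj₁ (path i)) , (λ i → proj₁ (proj₂ (path i))) , disjoint
      where
      P : Fin (length M₁) → ABWalk (Adjacent (edgesAvoiding [])) M₁ M₂
      P = proj₁ L
      -- the |M₁| walks start at distinct vertices of M₁, hence at all of them
      starts-injective : ∀ {i j} → ABWalk.source (P i) ≡ ABWalk.source (P j) → i ≡ j
      starts-injective {i} {j} e = linkage-meet L (start∈ (ABWalk.route (P i)))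
                                     (subst (_∈ vertsAB (P j)) (sym e) (start∈ (ABWalk.route (P j))))
      walkAt : ∀ i → Σ (Fin (length M₁)) λ j → ABWalk.source (P j) ≡ lookup M₁ i
      walkAt i = injection-onto M₁ (ABWalk.source ∘ P) starts-injective (ABWalk.source∈ ∘ P) ≤-refl (∈-lookup i)
      τ : Fin (length M₁) → Fin (length M₁)
      τ i = proj₁ (walkAt i)
      σ : Fin (length M₁) → Fin (length M₂)
      σ i = index (ABWalk.target∈ (P (τ i)))
      path : ∀ i → Σ (List Vert) λ Q → IsPathIn Adj (lookup M₁ i) (lookup M₂ (σ i)) Q × Q ⊆ vertsAB (P (τ i))
      path i = pathAlong (ABWalk.route (P (τ i))) (proj₂ (walkAt i)) (lookup-index (ABWalk.target∈ (P (τ i))))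
      disjoint : ∀ i j → i ≢ j → (t : Vert) → t ∈ proj₁ (path i) → t ∉ proj₁ (path j)
      disjoint i j i≢j t t∈ t∈' =
        i≢j (lookup-injective u₁ (begin-sources (linkage-meet L (proj₂ (proj₂ (path i)) t∈) (proj₂ (proj₂ (path j)) t∈'))))
        where
        begin-sources : τ i ≡ τ j → lookup M₁ i ≡ lookup M₁ j
        begin-sources e = trans (sym (proj₂ (walkAt i))) (trans (cong (ABWalk.source ∘ P) e) (proj₂ (walkAt j)))

    -- part (b): Menger between the neighbours of x and M in the graph without x
    module FanAt (x : Vert) where
      neighbours : List Vert
      neighbours = filter (λ a → Adj? x a ×-dec ¬? (a ≟ x)) vertices

      without-x : Edges
      without-x = edgesAvoiding (x ∷ [])

      avoids-x : ∀ {xs} → All (x ≢_) xs → Avoids (x ∷ []) xs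
      avoids-x = All.map λ { x≢t (here refl) → x≢t refl }

      -- a separator Z of the neighbours of x from M (x ∉ M) in the graph without x has at
      -- least |M| vertices: deleting Z∖x (at most k vertices) leaves x joined to some
      -- m ∈ M outside Z, and that path minus x runs from a neighbour to m avoiding Z
      no-small-separator : (M : List Vert) → x ∉ M → Unique M → length M ≤ suc k → ∀ Z →
                           length Z < length M → Separates (Adjacent without-x) neighbours M Z → ⊥
      no-small-separator M x∉M u small Z |Z|< sep with outside M Z u |Z|<
      ... | m , m∈ , m∉Z = leave w uw avw
        where
        open Delete Z x
        |Z∖x|≤k : length S∖s ≤ k
        |Z∖x|≤k = ≤-trans (length-filter keep? Z) (≤-pred (≤-trans |Z|< small))
        conn : Σ (List Vert) λ P → IsPathIn Adj x m P × All (λ t → t ∉ S∖s) P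
        conn = connected S∖s |Z∖x|≤k x m s∉ (m∉Z ∘ ⊆S)
        walk : Σ (Walk Adj x m) λ w → verts w ≡ proj₁ conn
        walk = path→walk (proj₁ conn) (proj₁ (proj₂ conn))
        w : Walk Adj x m
        w = proj₁ walk
        uw : Unique (verts w)
        uw = subst Unique (sym (proj₂ walk)) (proj₂ (proj₂ (proj₂ (proj₁ (proj₂ conn)))))
        avw : Avoids S∖s (verts w)
        avw = subst (Avoids S∖s) (sym (proj₂ walk)) (proj₂ (proj₂ conn))
        leave : (w : Walk Adj x m) → Unique (verts w) → Avoids S∖s (verts w) → ⊥
        leave [ _ ] _ _ = x∉M m∈
        leave (_ ∷⟨ r ⟩ w') (x∉w' ∷ _) (_ ∷ av) =
          let (w'' , e) = toAvoiding {X = x ∷ []} w' (avoids-x x∉w')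
              a≢x : _ ≢ x
              a≢x e = All.lookup x∉w' (start∈ w') (sym e)
          in sep (abw (∈-filter⁺ _ (all-vertices _) (r , a≢x)) m∈ w'')
                 (subst (Avoids Z) (sym e) (avoids-S av (All.map (λ x≢t t≡x → x≢t (sym t≡x)) x∉w')))

      -- for x ∉ M: disjoint walks from the neighbours of x to M avoiding x, each preceded by x
      fan-outside : (M : List Vert) → x ∉ M → Unique M → length M ≤ suc k → FanFrom x M
      fan-outside M x∉M u small with menger without-x neighbours M (length M)
      ... | inj₂ (Z , |Z|< , sep) = ⊥-elim (no-small-separator M x∉M u small Z |Z|< sep)
      ... | inj₁ L = (λ i → x ∷ proj₁ (path i)) , fan-path , disjoint
        where
        P : Fin (length M) → ABWalk (Adjacent without-x) neighbours M
        P = proj₁ L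
        -- the |M| walks end at distinct vertices of M, hence at all of them
        ends-injective : ∀ {i j} → ABWalk.target (P i) ≡ ABWalk.target (P j) → i ≡ j
        ends-injective {i} {j} e = linkage-meet L (end∈ (ABWalk.route (P i)))
                                     (subst (_∈ vertsAB (P j)) (sym e) (end∈ (ABWalk.route (P j))))
        walkTo : ∀ i → Σ (Fin (length M)) λ j → ABWalk.target (P j) ≡ lookup M i
        walkTo i = injection-onto M (ABWalk.target ∘ P) ends-injective (ABWalk.target∈ ∘ P) ≤-refl (∈-lookup i)
        τ : Fin (length M) → Fin (length M)
        τ i = proj₁ (walkTo i)
        start-neighbour : ∀ i → Adj x (ABWalk.source (P (τ i))) × ABWalk.source (P (τ i)) ≢ x
        start-neighbour i = proj₂ (∈-filter⁻ _ {xs = vertices} (ABWalk.source∈ (P (τ i))))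
        path : ∀ i → Σ (List Vert) λ Q → IsPathIn Adj (ABWalk.source (P (τ i))) (lookup M i) Q × Q ⊆ vertsAB (P (τ i))
        path i = pathAlong (ABWalk.route (P (τ i))) refl (proj₂ (walkTo i))
        x∉path : ∀ i → x ∉ proj₁ (path i)
        x∉path i m = avoids-∈ (avoiding-avoids (ABWalk.route (P (τ i))) λ { (here e) → proj₂ (start-neighbour i) e })
                       (proj₂ (proj₂ (path i)) m) (here refl)
        fan-path : ∀ i → IsPathIn Adj x (lookup M i) (x ∷ proj₁ (path i))
        fan-path i = cons-path (proj₁ (path i)) (proj₁ (proj₂ (path i))) (proj₁ (start-neighbour i)) (x∉path i)
        disjoint : ∀ i j → i ≢ j → (t : Vert) → t ∈ x ∷ proj₁ (path i) → t ∈ x ∷ proj₁ (path j) → t ≡ x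
        disjoint i j i≢j t (here e) _ = e
        disjoint i j i≢j t (there _) (here e) = e
        disjoint i j i≢j t (there t∈) (there t∈') =
          ⊥-elim (i≢j (lookup-injective u (trans (sym (proj₂ (walkTo i)))
            (trans (cong (ABWalk.target ∘ P) (linkage-meet L (proj₂ (proj₂ (path i)) t∈) (proj₂ (proj₂ (path j)) t∈')))
                   (proj₂ (walkTo j))))))

      -- if x ∈ M, the path to x is x itself and the others form a fan to M∖x
      fan : (M : List Vert) → Unique M → length M ≤ suc k → FanFrom x M
      fan M u small with x ∈? M
      ... | no x∉M = fan-outside M x∉M u small
      ... | yes _ = (λ i → proj₁ (path i)) , (λ i → proj₁ (proj₂ (path i))) , disjoint
        where
        open Delete M x
        F : FanFrom x S∖s
        F = fan-outside S∖s s∉ (Unique.filter⁺ keep? u) (≤-trans (length-filter keep? M) small)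
        PathTo : Fin (length M) → Set
        PathTo i = Σ (List Vert) λ Q → IsPathIn Adj x (lookup M i) Q ×
                     ((lookup M i ≡ x × Q ≡ x ∷ []) ⊎ Σ (Fin (length S∖s)) λ j → lookup M i ≡ lookup S∖s j × Q ≡ proj₁ F j)
        path : ∀ i → PathTo i
        path i with lookup M i ≟ x
        ... | yes e = (x ∷ []) , (refl , cong Data.Maybe.just (sym e) , [-] , ([] ∷ [])) , inj₁ (e , refl)
          where import Data.Maybe
        ... | no n = let m = ∈-filter⁺ keep? {xs = M} (∈-lookup i) n
                         e = lookup-index m
                     in proj₁ F (index m) , subst (λ y → IsPathIn Adj x y (proj₁ F (index m))) (sym e) (proj₁ (proj₂ F) (index m)) ,
                        inj₂ (index m , e , refl)
        disjoint : ∀ i j → i ≢ j → (t : Vert) → t ∈ proj₁ (path i) → t ∈ proj₁ (path j) → t ≡ x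
        disjoint i j i≢j t t∈ t∈' with path i | path j
        ... | (_ , _ , inj₁ (_ , refl)) | _ with t∈
        ...   | here e = e
        disjoint i j i≢j t t∈ t∈' | _ | (_ , _ , inj₁ (_ , refl)) with t∈'
        ...   | here e = e
        disjoint i j i≢j t t∈ t∈' | (_ , _ , inj₂ (i' , e , refl)) | (_ , _ , inj₂ (j' , e' , refl)) with i' Fin.≟ j'
        ... | yes refl = ⊥-elim (i≢j (lookup-injective u (trans e (sym e'))))
        ... | no i'≢j' = proj₂ (proj₂ F) i' j' i'≢j' t t∈ t∈'

module Cyclic where
  open import Data.Nat using (ℕ; zero; suc; _+_; _*_; _<_; _≤_; _<?_; _≤?_; s≤s; _∸_)
  open import Data.Nat.Properties
  open import Data.Fin using (Fin; toℕ; zero; suc; fromℕ<)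
  open import Data.Fin.Properties using (toℕ<n; toℕ-fromℕ<; toℕ-injective)
  open import Data.Product using (Σ; _×_; _,_)
  open import Data.Sum using (_⊎_; inj₁; inj₂)
  open import Data.Empty using (⊥; ⊥-elim)
  open import Relation.Nullary using (yes; no)
  open import Relation.Binary.PropositionalEquality using (_≡_; refl; sym; trans; cong; subst; module ≡-Reasoning)

  next : ∀ {n} → Fin n → Fin n
  next {suc m} a with suc (toℕ a) <? suc m
  ... | yes lt = fromℕ< lt
  ... | no _ = zero

  next-spec : ∀ {n} (a : Fin n) → SuccMod n (toℕ a) (toℕ (next a))
  next-spec {suc m} a with suc (toℕ a) <? suc m
  ... | yes lt = inj₁ (lt , toℕ-fromℕ< lt)
  ... | no nlt = inj₂ (≤-antisym (toℕ<n a) (≮⇒≥ nlt) , refl)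

  shift : ∀ {n} → Fin n → ℕ → Fin n
  shift a zero = a
  shift a (suc t) = next (shift a t)

  ShiftSpec : ∀ {n} → Fin n → ℕ → Set
  ShiftSpec {n} a t = (toℕ a + t < n × toℕ (shift a t) ≡ toℕ a + t) ⊎ (n ≤ toℕ a + t × toℕ (shift a t) + n ≡ toℕ a + t)

  shift-spec : ∀ {n} (a : Fin n) t → t ≤ n → ShiftSpec a t
  shift-spec {n} a zero _ = inj₁ (subst (_< n) (sym (+-identityʳ _)) (toℕ<n a) , sym (+-identityʳ _))
  shift-spec {n} a (suc t) st≤n with shift-spec a t (≤-trans (n≤1+n t) st≤n) | next-spec (shift a t)
  ... | inj₁ (lt , e) | inj₁ (lt' , e') =
        inj₁ (subst (_< n) (trans (cong suc e) (sym (+-suc (toℕ a) t))) lt' , trans e' (trans (cong suc e) (sym (+-suc (toℕ a) t))))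
  ... | inj₁ (lt , e) | inj₂ (eq , e') =
        inj₂ (subst (n ≤_) (trans (sym eq) (trans (cong suc e) (sym (+-suc (toℕ a) t)))) ≤-refl ,
              trans (cong (_+ n) e') (trans (sym eq) (trans (cong suc e) (sym (+-suc (toℕ a) t)))))
  ... | inj₂ (le , e) | inj₁ (lt' , e') =
        inj₂ (≤-trans le (subst (toℕ a + t ≤_) (sym (+-suc (toℕ a) t)) (n≤1+n _)) ,
              trans (cong (_+ n) e') (trans (cong suc e) (sym (+-suc (toℕ a) t))))
  ... | inj₂ (le , e) | inj₂ (eq , e') = ⊥-elim (contra (toℕ (shift a t)) (toℕ a) t eq e (toℕ<n a) st≤n)
    where
    contra : ∀ s a t → suc s ≡ n → s + n ≡ a + t → a < n → suc t ≤ n → ⊥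
    contra s a t refl e a<n t<n = <-irrefl (sym e) (subst (a + t <_) (sym (+-suc s s)) (s≤s (+-mono-≤ (≤-pred a<n) (≤-pred t<n))))

  private
    wrapped-beyond : ∀ {n} a t t' → a + t + n ≡ a + t' → n ≤ t'
    wrapped-beyond {n} a t t' q = subst (n ≤_) (+-cancelˡ-≡ a (t + n) t' (trans (sym (+-assoc a t n)) q)) (m≤n+m n t)

  shift-injective : ∀ {n} (a : Fin n) {t t'} → t < n → t' < n → shift a t ≡ shift a t' → t ≡ t'
  shift-injective {n} a {t} {t'} lt lt' e with shift-spec a t (<⇒≤ lt) | shift-spec a t' (<⇒≤ lt')
  ... | inj₁ (_ , e1) | inj₁ (_ , e2) = +-cancelˡ-≡ (toℕ a) t t' (trans (sym e1) (trans (cong toℕ e) e2))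
  ... | inj₂ (_ , e1) | inj₂ (_ , e2) = +-cancelˡ-≡ (toℕ a) t t' (trans (sym e1) (trans (cong (λ z → toℕ z + n) e) e2))
  ... | inj₁ (_ , e1) | inj₂ (_ , e2) =
        ⊥-elim (<⇒≱ lt' (wrapped-beyond (toℕ a) t t' (trans (cong (_+ n) (trans (sym e1) (cong toℕ e))) e2)))
  ... | inj₂ (_ , e1) | inj₁ (_ , e2) =
        ⊥-elim (<⇒≱ lt (wrapped-beyond (toℕ a) t' t (trans (cong (_+ n) (trans (sym e2) (cong toℕ (sym e)))) e1)))

  shift-n : ∀ {n} (a : Fin n) → shift a n ≡ a
  shift-n {n} a with shift-spec a n ≤-refl
  ... | inj₁ (lt , _) = ⊥-elim (m+n≮n (toℕ a) n lt)
  ... | inj₂ (_ , e) = toℕ-injective (+-cancelʳ-≡ n _ _ e)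

  shift-shift : ∀ {n} (a : Fin n) t u → shift (shift a t) u ≡ shift a (u + t)
  shift-shift a t zero = refl
  shift-shift a t (suc u) = cong next (shift-shift a t u)

  offset : ∀ {n} (a b : Fin n) → Σ ℕ λ k → k < n × shift a k ≡ b
  offset {n} a b with toℕ a ≤? toℕ b
  ... | yes le = toℕ b ∸ toℕ a , ≤-<-trans (m∸n≤m (toℕ b) (toℕ a)) (toℕ<n b) , toℕ-injective eq
    where
    k : ℕ
    k = toℕ b ∸ toℕ a
    eq : toℕ (shift a k) ≡ toℕ b
    eq with shift-spec a k (<⇒≤ (≤-<-trans (m∸n≤m (toℕ b) (toℕ a)) (toℕ<n b)))
    ... | inj₁ (_ , e) = trans e (m+[n∸m]≡n le)
    ... | inj₂ (ge , _) = ⊥-elim (<⇒≱ (toℕ<n b) (subst (n ≤_) (m+[n∸m]≡n le) ge))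
  ... | no nle = k , klt , toℕ-injective eq
    where
    k : ℕ
    k = n ∸ toℕ a + toℕ b
    ba : toℕ b < toℕ a
    ba = ≰⇒> nle
    klt : k < n
    klt = subst (k <_) (m∸n+n≡m (<⇒≤ (toℕ<n a))) (+-monoʳ-< (n ∸ toℕ a) ba)
    ak : toℕ a + k ≡ n + toℕ b
    ak = trans (sym (+-assoc (toℕ a) (n ∸ toℕ a) (toℕ b))) (cong (_+ toℕ b) (m+[n∸m]≡n (<⇒≤ (toℕ<n a))))
    eq : toℕ (shift a k) ≡ toℕ b
    eq with shift-spec a k (<⇒≤ klt)
    ... | inj₁ (lt , _) = ⊥-elim (<⇒≱ lt (subst (n ≤_) (sym ak) (m≤m+n n _)))
    ... | inj₂ (_ , e) = +-cancelʳ-≡ n _ _ (trans e (trans ak (+-comm n (toℕ b))))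

  double-suc : ∀ i → 2 * suc i ≡ suc (suc (2 * i))
  double-suc i = *-suc 2 i

  double< : ∀ {i p} → i < p → 2 * i < 2 * p
  double< {i} {p} lt = ≤-trans (n≤1+n _) (subst (_≤ 2 * p) (double-suc i) (*-monoʳ-≤ 2 lt))

  odd< : ∀ {i p} → i < p → suc (2 * i) < 2 * p
  odd< {i} {p} lt = subst (_≤ 2 * p) (double-suc i) (*-monoʳ-≤ 2 lt)

  module Double (p : ℕ) where
    double : Fin p → Fin (2 * p)
    double i = fromℕ< (double< (toℕ<n i))

    toℕ-double : ∀ i → toℕ (double i) ≡ 2 * toℕ i
    toℕ-double i = toℕ-fromℕ< (double< (toℕ<n i))

    toℕ-next-double : ∀ i → toℕ (next (double i)) ≡ suc (2 * toℕ i)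
    toℕ-next-double i with next-spec (double i)
    ... | inj₁ (_ , e) = trans e (cong suc (toℕ-double i))
    ... | inj₂ (e , _) = ⊥-elim (<-irrefl (trans (cong suc (sym (toℕ-double i))) e) (odd< (toℕ<n i)))

    double-next : ∀ i → double (next i) ≡ next (next (double i))
    double-next i = toℕ-injective (go (next-spec i) (next-spec (next (double i))))
      where
      go : SuccMod p (toℕ i) (toℕ (next i)) → SuccMod (2 * p) (toℕ (next (double i))) (toℕ (next (next (double i)))) →
           toℕ (double (next i)) ≡ toℕ (next (next (double i)))
      go (inj₁ (_ , e)) (inj₁ (_ , e')) = begin
        toℕ (double (next i))        ≡⟨ toℕ-double (next i) ⟩
        2 * toℕ (next i)             ≡⟨ cong (2 *_) e ⟩
        2 * suc (toℕ i)              ≡⟨ double-suc (toℕ i) ⟩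
        suc (suc (2 * toℕ i))        ≡⟨ cong suc (sym (toℕ-next-double i)) ⟩
        suc (toℕ (next (double i)))  ≡⟨ sym e' ⟩
        toℕ (next (next (double i))) ∎
        where open ≡-Reasoning
      go (inj₁ (lt , e)) (inj₂ (e' , _)) = ⊥-elim (<-irrefl (trans (double-suc (toℕ i)) (trans (cong suc (sym (toℕ-next-double i))) e')) (double< lt))
      go (inj₂ (e , z)) (inj₁ (lt' , _)) =
        ⊥-elim (<-irrefl (trans {j = suc (suc (2 * toℕ i))} (cong suc (toℕ-next-double i))
                                (trans (sym (double-suc (toℕ i))) (cong (2 *_) e))) lt')
      go (inj₂ (e , z)) (inj₂ (_ , z')) = trans (toℕ-double (next i)) (trans (cong (2 *_) z) (sym z'))

    half : ∀ m → Σ ℕ λ q → m ≡ 2 * q ⊎ m ≡ suc (2 * q)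
    half zero = 0 , inj₁ refl
    half (suc m) with half m
    ... | q , inj₁ e = q , inj₂ (cong suc e)
    ... | q , inj₂ e = suc q , inj₁ (trans (cong suc e) (sym (double-suc q)))

    parity : ∀ (j : Fin (2 * p)) → Σ (Fin p) λ i → j ≡ double i ⊎ j ≡ next (double i)
    parity j with half (toℕ j)
    ... | q , inj₁ e = fromℕ< q<p , inj₁ (toℕ-injective (trans e (sym (trans (toℕ-double (fromℕ< q<p)) (cong (2 *_) (toℕ-fromℕ< q<p))))))
      where
      q<p : q < p
      q<p = *-cancelˡ-< 2 q p (subst (_< 2 * p) e (toℕ<n j))
    ... | q , inj₂ e = fromℕ< q<p ,
          inj₂ (toℕ-injective (trans e (sym (trans (toℕ-next-double (fromℕ< q<p)) (cong (λ z → suc (2 * z)) (toℕ-fromℕ< q<p))))))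
      where
      q<p : q < p
      q<p = *-cancelˡ-< 2 q p (<-trans (n<1+n (2 * q)) (subst (_< 2 * p) e (toℕ<n j)))

    double-shift : ∀ c k → double (shift c k) ≡ shift (double c) (2 * k)
    double-shift c zero = refl
    double-shift c (suc k) = begin
      double (next (shift c k))            ≡⟨ double-next (shift c k) ⟩
      next (next (double (shift c k)))     ≡⟨ cong (λ z → next (next z)) (double-shift c k) ⟩
      shift (double c) (suc (suc (2 * k))) ≡⟨ cong (shift (double c)) (sym (double-suc k)) ⟩
      shift (double c) (2 * suc k)         ∎
      where open ≡-Reasoning

module FpGraph (p : ℕ) where
  open import Data.Nat using (ℕ; suc; _*_; _<?_)
  import Data.Nat as ℕ
  open import Data.Fin using (Fin; toℕ)
  import Data.Fin as Fin
  open import Data.List using (List; []; _∷_; _++_; map; allFin)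
  open import Data.List.Membership.Propositional using (_∈_)
  open import Data.List.Membership.Propositional.Properties using (∈-map⁺; ∈-++⁺ˡ; ∈-++⁺ʳ; ∈-allFin)
  open import Data.List.Relation.Unary.Any using (here)
  open import Data.Sum using (_⊎_; inj₁; inj₂)
  open import Relation.Nullary using (Dec; yes; no)
  open import Relation.Nullary.Decidable using (_×-dec_; _⊎-dec_; map′)
  open import Relation.Binary.PropositionalEquality using (_≡_; refl; cong)

  _≟_ : (a b : V p) → Dec (a ≡ b)
  cu i ≟ cu j = map′ (cong cu) (λ { refl → refl }) (i Fin.≟ j)
  cu i ≟ cv j = no λ ()
  cu i ≟ cw j = no λ ()
  cu i ≟ cz = no λ ()
  cv i ≟ cu j = no λ ()
  cv i ≟ cv j = map′ (cong cv) (λ { refl → refl }) (i Fin.≟ j)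
  cv i ≟ cw j = no λ ()
  cv i ≟ cz = no λ ()
  cw i ≟ cu j = no λ ()
  cw i ≟ cv j = no λ ()
  cw i ≟ cw j = map′ (cong cw) (λ { refl → refl }) (i Fin.≟ j)
  cw i ≟ cz = no λ ()
  cz ≟ cu j = no λ ()
  cz ≟ cv j = no λ ()
  cz ≟ cw j = no λ ()
  cz ≟ cz = yes refl

  vertices : List (V p)
  vertices = map cu (allFin p) ++ (map cv (allFin (2 * p)) ++ (map cw (allFin (2 * p)) ++ (cz ∷ [])))

  all-vertices : ∀ a → a ∈ vertices
  all-vertices (cu i) = ∈-++⁺ˡ (∈-map⁺ cu (∈-allFin i))
  all-vertices (cv i) = ∈-++⁺ʳ (map cu (allFin p)) (∈-++⁺ˡ (∈-map⁺ cv (∈-allFin i)))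
  all-vertices (cw i) = ∈-++⁺ʳ (map cu (allFin p)) (∈-++⁺ʳ (map cv (allFin (2 * p))) (∈-++⁺ˡ (∈-map⁺ cw (∈-allFin i))))
  all-vertices cz = ∈-++⁺ʳ (map cu (allFin p)) (∈-++⁺ʳ (map cv (allFin (2 * p))) (∈-++⁺ʳ (map cw (allFin (2 * p))) (here refl)))

  SuccMod? : ∀ n i j → Dec (SuccMod n i j)
  SuccMod? n i j = ((suc i <? n) ×-dec (j ℕ.≟ suc i)) ⊎-dec ((suc i ℕ.≟ n) ×-dec (j ℕ.≟ 0))

  Edge? : (a b : V p) → Dec (Edge p a b)
  Edge? (cu i) (cu j) = map′ (uu i j) (λ { (uu _ _ s) → s }) (SuccMod? p (toℕ i) (toℕ j))
  Edge? (cu i) (cv j) =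
    map′ to from ((toℕ j ℕ.≟ 2 * toℕ i) ⊎-dec ((toℕ j ℕ.≟ suc (2 * toℕ i)) ⊎-dec SuccMod? (2 * p) (toℕ j) (2 * toℕ i)))
    where
    UV : Set
    UV = toℕ j ≡ 2 * toℕ i ⊎ (toℕ j ≡ suc (2 * toℕ i) ⊎ SuccMod (2 * p) (toℕ j) (2 * toℕ i))
    to : UV → Edge p (cu i) (cv j)
    to (inj₁ e) = uv0 i j e
    to (inj₂ (inj₁ e)) = uv+ i j e
    to (inj₂ (inj₂ s)) = uv- i j s
    from : Edge p (cu i) (cv j) → UV
    from (uv0 _ _ e) = inj₁ e
    from (uv+ _ _ e) = inj₂ (inj₁ e)
    from (uv- _ _ s) = inj₂ (inj₂ s)
  Edge? (cu i) (cw j) = no λ ()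
  Edge? (cu i) cz = no λ ()
  Edge? (cv i) (cu j) = no λ ()
  Edge? (cv i) (cv j) = map′ (vv i j) (λ { (vv _ _ s) → s }) (SuccMod? (2 * p) (toℕ i) (toℕ j))
  Edge? (cv i) (cw j) = map′ to from ((i Fin.≟ j) ⊎-dec SuccMod? (2 * p) (toℕ i) (toℕ j))
    where
    VW : Set
    VW = i ≡ j ⊎ SuccMod (2 * p) (toℕ i) (toℕ j)
    to : VW → Edge p (cv i) (cw j)
    to (inj₁ refl) = vw0 i
    to (inj₂ s) = vw+ i j s
    from : Edge p (cv i) (cw j) → VW
    from (vw0 _) = inj₁ refl
    from (vw+ _ _ s) = inj₂ s
  Edge? (cv i) cz = no λ ()
  Edge? (cw i) (cu j) = no λ ()
  Edge? (cw i) (cv j) = no λ ()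
  Edge? (cw i) (cw j) = map′ (ww i j) (λ { (ww _ _ s) → s }) (SuccMod? (2 * p) (toℕ i) (toℕ j))
  Edge? (cw i) cz = yes (wz i)
  Edge? cz b = no λ ()

  Adj? : (a b : V p) → Dec (Adj p a b)
  Adj? a b = Edge? a b ⊎-dec Edge? b a

  Adj-sym : ∀ {a b} → Adj p a b → Adj p b a
  Adj-sym (inj₁ e) = inj₂ e
  Adj-sym (inj₂ e) = inj₁ e

-- Vertices of F_p named relative to a base index c ∈ ℤ/p:  pU k = u_{c+k},
-- pV k = v_{2c+k},  pW k = w_{2c+k},  pZ = z.  Steps between names are edges of F_p
-- at every base index, so a route written once as a walk of names (its adjacencies
-- checked by typing) is a walk of F_p around every vertex.
module Places where
  open import Data.Nat using (ℕ; suc; _*_; _<_; _<?_)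
  import Data.Nat as ℕ
  open import Data.List using (List; []; _∷_)
  open import Data.List.Membership.Propositional using (_∉_)
  open import Data.List.Relation.Unary.All using (All; []; _∷_)
  import Data.List.Relation.Unary.All as All
  open import Data.List.Relation.Unary.AllPairs using (AllPairs; []; _∷_; allPairs?)
  open import Data.Product using (Σ; _×_; _,_; proj₂)
  open import Data.Sum using (_⊎_; inj₁; inj₂)
  open import Data.Unit using (⊤; tt)
  open import Relation.Nullary using (Dec; yes; no)
  open import Relation.Nullary.Decidable using (¬?; _×-dec_; map′; toWitness)
  open import Relation.Binary.Definitions using (DecidableEquality)
  open import Relation.Binary.PropositionalEquality using (refl; cong)

  data Place : Set where
    pU pV pW : ℕ → Place
    pZ : Place

  _≟ₚ_ : DecidableEquality Place
  pU k ≟ₚ pU m = map′ (cong pU) (λ { refl → refl }) (k ℕ.≟ m)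
  pV k ≟ₚ pV m = map′ (cong pV) (λ { refl → refl }) (k ℕ.≟ m)
  pW k ≟ₚ pW m = map′ (cong pW) (λ { refl → refl }) (k ℕ.≟ m)
  pZ ≟ₚ pZ = yes refl
  pU _ ≟ₚ pV _ = no λ ()
  pU _ ≟ₚ pW _ = no λ ()
  pU _ ≟ₚ pZ = no λ ()
  pV _ ≟ₚ pU _ = no λ ()
  pV _ ≟ₚ pW _ = no λ ()
  pV _ ≟ₚ pZ = no λ ()
  pW _ ≟ₚ pU _ = no λ ()
  pW _ ≟ₚ pV _ = no λ ()
  pW _ ≟ₚ pZ = no λ ()
  pZ ≟ₚ pU _ = no λ ()
  pZ ≟ₚ pV _ = no λ ()
  pZ ≟ₚ pW _ = no λ ()

  data Step : Place → Place → Set where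
    UU  : ∀ k → Step (pU k) (pU (suc k))
    UV₀ : ∀ k → Step (pU k) (pV (2 * k))
    UV₊ : ∀ k → Step (pU k) (pV (suc (2 * k)))
    UV₋ : ∀ k → Step (pU (suc k)) (pV (suc (2 * k)))
    VV  : ∀ k → Step (pV k) (pV (suc k))
    VW₀ : ∀ k → Step (pV k) (pW k)
    VW₊ : ∀ k → Step (pV k) (pW (suc k))
    WW  : ∀ k → Step (pW k) (pW (suc k))
    WZ  : ∀ k → Step (pW k) pZ

  PlaceAdj : Place → Place → Set
  PlaceAdj a b = Step a b ⊎ Step b a

  -- names with small offsets (p ≥ 3 makes them name distinct vertices)
  Small : Place → Set
  Small (pU k) = k < 3
  Small (pV k) = k < 6
  Small (pW k) = k < 6
  Small pZ = ⊤

  small? : ∀ a → Dec (Small a)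
  small? (pU k) = k <? 3
  small? (pV k) = k <? 6
  small? (pW k) = k <? 6
  small? pZ = yes tt

  open Walks _≟ₚ_ using (Walk; [_]; _∷⟨_⟩_; verts; tailV)
  open import Data.List.Membership.DecPropositional _≟ₚ_ using (_∈?_)

  Route : Place → Set
  Route X = Σ ℕ λ m → Walk PlaceAdj X (pW m)

  routeVerts : ∀ {X} → Route X → List Place
  routeVerts (_ , w) = verts w

  Apart : List Place → List Place → Set
  Apart xs ys = All (_∉ ys) xs

  FanOfRoutes : (X : Place) → List (Route X) → Set
  FanOfRoutes X rs = All (λ r → All Small (routeVerts r)) rs ×
                     AllPairs (λ r r' → Apart (tailV (proj₂ r)) (tailV (proj₂ r'))) rs

  -- being a fan of routes is decidable, so each concrete fan below is checked by evaluation
  fanOfRoutes? : ∀ X rs → Dec (FanOfRoutes X rs)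
  fanOfRoutes? X rs =
    All.all? (λ r → All.all? small? (routeVerts r)) rs ×-dec
    allPairs? (λ r r' → All.all? (λ a → ¬? (a ∈? tailV (proj₂ r'))) (tailV (proj₂ r))) rs

  -- Five routes to C'' from each kind of vertex, pairwise meeting only at their start:
  -- from u_i and from v_{2i}, v_{2i+1} (named at base c = i - 1), and from z.
  routesFromU : List (Route (pU 1))
  routesFromU =
      (2 , pU 1 ∷⟨ inj₁ (UV₀ 1) ⟩ pV 2 ∷⟨ inj₁ (VW₀ 2) ⟩ [ pW 2 ])
    ∷ (4 , pU 1 ∷⟨ inj₁ (UV₊ 1) ⟩ pV 3 ∷⟨ inj₁ (VW₊ 3) ⟩ [ pW 4 ])
    ∷ (1 , pU 1 ∷⟨ inj₁ (UV₋ 0) ⟩ pV 1 ∷⟨ inj₁ (VW₀ 1) ⟩ [ pW 1 ])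
    ∷ (5 , pU 1 ∷⟨ inj₁ (UU 1) ⟩ pU 2 ∷⟨ inj₁ (UV₀ 2) ⟩ pV 4 ∷⟨ inj₁ (VW₊ 4) ⟩ [ pW 5 ])
    ∷ (0 , pU 1 ∷⟨ inj₂ (UU 0) ⟩ pU 0 ∷⟨ inj₁ (UV₀ 0) ⟩ pV 0 ∷⟨ inj₁ (VW₀ 0) ⟩ [ pW 0 ])
    ∷ []

  routesFromVeven : List (Route (pV 2))
  routesFromVeven =
      (2 , pV 2 ∷⟨ inj₁ (VW₀ 2) ⟩ [ pW 2 ])
    ∷ (3 , pV 2 ∷⟨ inj₁ (VW₊ 2) ⟩ [ pW 3 ])
    ∷ (4 , pV 2 ∷⟨ inj₁ (VV 2) ⟩ pV 3 ∷⟨ inj₁ (VW₊ 3) ⟩ [ pW 4 ])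
    ∷ (1 , pV 2 ∷⟨ inj₂ (VV 1) ⟩ pV 1 ∷⟨ inj₁ (VW₀ 1) ⟩ [ pW 1 ])
    ∷ (5 , pV 2 ∷⟨ inj₂ (UV₀ 1) ⟩ pU 1 ∷⟨ inj₁ (UU 1) ⟩ pU 2 ∷⟨ inj₁ (UV₀ 2) ⟩ pV 4 ∷⟨ inj₁ (VW₊ 4) ⟩ [ pW 5 ])
    ∷ []

  routesFromVodd : List (Route (pV 3))
  routesFromVodd =
      (3 , pV 3 ∷⟨ inj₁ (VW₀ 3) ⟩ [ pW 3 ])
    ∷ (4 , pV 3 ∷⟨ inj₁ (VW₊ 3) ⟩ [ pW 4 ])
    ∷ (2 , pV 3 ∷⟨ inj₂ (VV 2) ⟩ pV 2 ∷⟨ inj₁ (VW₀ 2) ⟩ [ pW 2 ])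
    ∷ (5 , pV 3 ∷⟨ inj₁ (VV 3) ⟩ pV 4 ∷⟨ inj₁ (VW₊ 4) ⟩ [ pW 5 ])
    ∷ (1 , pV 3 ∷⟨ inj₂ (UV₊ 1) ⟩ pU 1 ∷⟨ inj₁ (UV₋ 0) ⟩ pV 1 ∷⟨ inj₁ (VW₀ 1) ⟩ [ pW 1 ])
    ∷ []

  routesFromZ : List (Route pZ)
  routesFromZ = (0 , spoke 0) ∷ (1 , spoke 1) ∷ (2 , spoke 2) ∷ (3 , spoke 3) ∷ (4 , spoke 4) ∷ []
    where
    spoke : ∀ k → Walk PlaceAdj pZ (pW k)
    spoke k = pZ ∷⟨ inj₂ (WZ k) ⟩ [ pW k ]

  fanU : FanOfRoutes (pU 1) routesFromU
  fanU = toWitness {a? = fanOfRoutes? (pU 1) routesFromU} tt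

  fanVeven : FanOfRoutes (pV 2) routesFromVeven
  fanVeven = toWitness {a? = fanOfRoutes? (pV 2) routesFromVeven} tt

  fanVodd : FanOfRoutes (pV 3) routesFromVodd
  fanVodd = toWitness {a? = fanOfRoutes? (pV 3) routesFromVodd} tt

  fanZ : FanOfRoutes pZ routesFromZ
  fanZ = toWitness {a? = fanOfRoutes? pZ routesFromZ} tt

-- κ(F_p) ≥ 5.  After deleting a set S of at most 4 vertices, every remaining vertex still
-- reaches the inner cycle C'' (it has five routes there meeting only at itself), and
-- any two remaining vertices of C'' are still joined (through z, or, if z ∈ S, along
-- one of four routes around C'' and C' meeting only at their ends).
module FpConnectivity (p : ℕ) (p≥3 : 3 ≤ p) where
  open import Data.Nat using (ℕ; zero; suc; _*_; _<_; _≤_; _≤′_; ≤′-refl; ≤′-step; _∸_; z≤n; s≤s)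
  import Data.Nat as ℕ
  import Data.Nat.Properties as ℕ
  open import Data.Fin using (Fin; toℕ; fromℕ<)
  import Data.Fin as Fin
  open import Data.List using (List; []; _∷_; map; length)
  open import Data.List.Membership.Propositional using (_∈_; _∉_)
  open import Data.List.Membership.Propositional.Properties using (∈-map⁻)
  open import Data.List.Relation.Unary.Any using (here; there)
  open import Data.List.Relation.Unary.All using (All; []; _∷_)
  open import Data.List.Relation.Unary.All.Properties using (anti-mono)
  import Data.List.Relation.Unary.All as All
  open import Data.List.Relation.Unary.AllPairs using (AllPairs; []; _∷_)
  open import Data.Product using (Σ; _×_; _,_; proj₁; proj₂)
  open import Data.Sum using (_⊎_; inj₁; inj₂)
  open import Data.Empty using (⊥-elim)
  open import Function using (_∘_)
  open import Relation.Nullary using (yes; no; ¬_)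
  open import Relation.Binary.PropositionalEquality using (_≡_; refl; sym; trans; cong; subst)

  open Cyclic
  open Double p
  open FpGraph p
  open Walks _≟_
  open Places using (Place; pU; pV; pW; pZ; Step; UU; UV₀; UV₊; UV₋; VV; VW₀; VW₊; WW; WZ; PlaceAdj; Small; Route; FanOfRoutes)
  module PW = Walks Places._≟ₚ_

  n : ℕ
  n = 2 * p

  u-u : ∀ i → Adj p (cu i) (cu (next i))
  u-u i = inj₁ (uu i (next i) (next-spec i))
  v-v : ∀ j → Adj p (cv j) (cv (next j))
  v-v j = inj₁ (vv j (next j) (next-spec j))
  w-w : ∀ j → Adj p (cw j) (cw (next j))
  w-w j = inj₁ (ww j (next j) (next-spec j))
  v-w : ∀ j → Adj p (cv j) (cw j)
  v-w j = inj₁ (vw0 j)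
  v-w⁺ : ∀ j → Adj p (cv j) (cw (next j))
  v-w⁺ j = inj₁ (vw+ j (next j) (next-spec j))
  w-z : ∀ j → Adj p (cw j) cz
  w-z j = inj₁ (wz j)
  u-v : ∀ i → Adj p (cu i) (cv (double i))
  u-v i = inj₁ (uv0 i (double i) (toℕ-double i))
  u-v⁺ : ∀ i → Adj p (cu i) (cv (next (double i)))
  u-v⁺ i = inj₁ (uv+ i (next (double i)) (toℕ-next-double i))
  u-v⁻ : ∀ i j → next j ≡ double i → Adj p (cu i) (cv j)
  u-v⁻ i j e = inj₁ (uv- i j (subst (SuccMod (2 * p) (toℕ j)) (trans (cong toℕ e) (toℕ-double i)) (next-spec j)))

  place : Fin p → Place → V p
  place c (pU k) = cu (shift c k)
  place c (pV k) = cv (shift (double c) k)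
  place c (pW k) = cw (shift (double c) k)
  place c pZ = cz

  place-step : ∀ c {a b} → Step a b → Adj p (place c a) (place c b)
  place-step c (UU k) = u-u (shift c k)
  place-step c (UV₀ k) = subst (λ j → Adj p (cu (shift c k)) (cv j)) (double-shift c k) (u-v (shift c k))
  place-step c (UV₊ k) = subst (λ j → Adj p (cu (shift c k)) (cv (next j))) (double-shift c k) (u-v⁺ (shift c k))
  place-step c (UV₋ k) = u-v⁻ (shift c (suc k)) (shift (double c) (suc (2 * k)))
    (sym (trans (double-shift c (suc k)) (cong (shift (double c)) (double-suc k))))
  place-step c (VV k) = v-v (shift (double c) k)
  place-step c (VW₀ k) = v-w (shift (double c) k)
  place-step c (VW₊ k) = v-w⁺ (shift (double c) k)
  place-step c (WW k) = w-w (shift (double c) k)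
  place-step c (WZ k) = w-z (shift (double c) k)

  n≥6 : 6 ≤ n
  n≥6 = ℕ.*-monoʳ-≤ 2 p≥3

  cu-injective : ∀ {i j} → cu {p} i ≡ cu j → i ≡ j
  cu-injective refl = refl
  cv-injective : ∀ {i j} → cv {p} i ≡ cv j → i ≡ j
  cv-injective refl = refl
  cw-injective : ∀ {i j} → cw {p} i ≡ cw j → i ≡ j
  cw-injective refl = refl

  place-injective : ∀ c {a b} → Small a → Small b → place c a ≡ place c b → a ≡ b
  place-injective c {pU k} {pU m} sa sb e =
    cong pU (shift-injective c (ℕ.<-≤-trans sa p≥3) (ℕ.<-≤-trans sb p≥3) (cu-injective e))
  place-injective c {pV k} {pV m} sa sb e =
    cong pV (shift-injective (double c) (ℕ.<-≤-trans sa n≥6) (ℕ.<-≤-trans sb n≥6) (cv-injective e))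
  place-injective c {pW k} {pW m} sa sb e =
    cong pW (shift-injective (double c) (ℕ.<-≤-trans sa n≥6) (ℕ.<-≤-trans sb n≥6) (cw-injective e))
  place-injective c {pZ} {pZ} sa sb e = refl
  place-injective c {pU _} {pV _} sa sb ()
  place-injective c {pU _} {pW _} sa sb ()
  place-injective c {pU _} {pZ} sa sb ()
  place-injective c {pV _} {pU _} sa sb ()
  place-injective c {pV _} {pW _} sa sb ()
  place-injective c {pV _} {pZ} sa sb ()
  place-injective c {pW _} {pU _} sa sb ()
  place-injective c {pW _} {pV _} sa sb ()
  place-injective c {pW _} {pZ} sa sb ()
  place-injective c {pZ} {pU _} sa sb ()
  place-injective c {pZ} {pV _} sa sb ()
  place-injective c {pZ} {pW _} sa sb ()

  realize : ∀ c {a b} → PW.Walk PlaceAdj a b → Walk (Adj p) (place c a) (place c b)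
  realize c [ a ] = [ place c a ]
  realize c (a ∷⟨ inj₁ s ⟩ w) = place c a ∷⟨ place-step c s ⟩ realize c w
  realize c (a ∷⟨ inj₂ s ⟩ w) = place c a ∷⟨ Adj-sym (place-step c s) ⟩ realize c w

  verts-realize : ∀ c {a b} (w : PW.Walk PlaceAdj a b) → verts (realize c w) ≡ map (place c) (PW.verts w)
  verts-realize c [ a ] = refl
  verts-realize c (a ∷⟨ inj₁ s ⟩ w) = cong (place c a ∷_) (verts-realize c w)
  verts-realize c (a ∷⟨ inj₂ s ⟩ w) = cong (place c a ∷_) (verts-realize c w)

  module RealizedFan (c : Fin p) (X : Place) (rs : List (Route X)) (fan : FanOfRoutes X rs) where
    realizedVerts : Route X → List (V p)
    realizedVerts r = map (place c) (PW.verts (proj₂ r))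

    meet-at-start : ∀ {r r'} → All Small (PW.verts (proj₂ r)) → All Small (PW.verts (proj₂ r')) →
                    Places.Apart (PW.tailV (proj₂ r)) (PW.tailV (proj₂ r')) →
                    PairwiseMeetIn realizedVerts (place c X ∷ []) r r'
    meet-at-start {r} {r'} small small' apart t∈ t∈' with ∈-map⁻ (place c) t∈ | ∈-map⁻ (place c) t∈'
    ... | a , a∈ , refl | b , b∈ , e with place-injective c (All.lookup small a∈) (All.lookup small' b∈) e
    ...   | refl with PW.start-or-tail (proj₂ r) a∈ | PW.start-or-tail (proj₂ r') b∈
    ...     | inj₁ refl | _ = here refl
    ...     | inj₂ _ | inj₁ refl = here refl
    ...     | inj₂ inner | inj₂ inner' = ⊥-elim (All.lookup apart inner inner')

    meet-pairwise : ∀ {rs} → All (λ r → All Small (PW.verts (proj₂ r))) rs →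
                    AllPairs (λ r r' → Places.Apart (PW.tailV (proj₂ r)) (PW.tailV (proj₂ r'))) rs →
                    AllPairs (PairwiseMeetIn realizedVerts (place c X ∷ [])) rs
    meet-pairwise [] [] = []
    meet-pairwise (small ∷ smalls) (apart ∷ aparts) =
      All.zipWith (λ (small' , ap) {t} → meet-at-start small small' ap {t}) (smalls , apart) ∷ meet-pairwise smalls aparts

    reach : ∀ S → length S < length rs → place c X ∉ S →
            Σ ℕ λ m → Σ (Walk (Adj p) (place c X) (cw (shift (double c) m))) λ w → Avoids S (verts w)
    reach S |S|< X∉S with route-avoiding realizedVerts (place c X ∷ []) S rs (meet-pairwise (proj₁ fan) (proj₂ fan)) (X∉S ∷ []) |S|<
    ... | (m , r) , _ , av = m , realize c r , subst (Avoids S) (sym (verts-realize c r)) av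

  ReachesC'' : List (V p) → V p → Set
  ReachesC'' S x = Σ (Fin n) λ j → Σ (Walk (Adj p) x (cw j)) λ w → Avoids S (verts w)

  via-fan : ∀ {S} c X rs → FanOfRoutes X rs → length S < length rs → ∀ {x} → place c X ≡ x → x ∉ S → ReachesC'' S x
  via-fan {S} c X rs fan |S|< refl x∉ with RealizedFan.reach c X rs fan S |S|< x∉
  ... | m , w , av = shift (double c) m , w , av

  -- the base index i - 1 at which u_i, v_{2i}, v_{2i+1} are named pU 1, pV 2, pV 3
  predecessor : Fin p → Fin p
  predecessor i = shift i (p ∸ 1)

  shift-predecessor : ∀ i → shift (predecessor i) 1 ≡ i
  shift-predecessor i = trans (shift-shift i (p ∸ 1) 1) (trans (cong (shift i) (ℕ.m+[n∸m]≡n (ℕ.≤-trans (s≤s z≤n) p≥3))) (shift-n i))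

  double-predecessor : ∀ i → shift (double (predecessor i)) 2 ≡ double i
  double-predecessor i = trans (sym (double-shift (predecessor i) 1)) (cong double (shift-predecessor i))

  reachC'' : ∀ S → length S ≤ 4 → ∀ x → x ∉ S → ReachesC'' S x
  reachC'' S |S|≤4 (cu i) = via-fan (predecessor i) (pU 1) Places.routesFromU Places.fanU (s≤s |S|≤4) (cong cu (shift-predecessor i))
  reachC'' S |S|≤4 (cv j) with parity j
  ... | i , inj₁ refl = via-fan (predecessor i) (pV 2) Places.routesFromVeven Places.fanVeven (s≤s |S|≤4) (cong cv (double-predecessor i))
  ... | i , inj₂ refl = via-fan (predecessor i) (pV 3) Places.routesFromVodd Places.fanVodd (s≤s |S|≤4) (cong (cv ∘ next) (double-predecessor i))
  reachC'' S |S|≤4 (cw j) x∉ = j , [ cw j ] , x∉ ∷ []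
  reachC'' S |S|≤4 cz = via-fan (fromℕ< (ℕ.≤-trans (s≤s z≤n) p≥3)) pZ Places.routesFromZ Places.fanZ (s≤s |S|≤4) refl

  module Run (f : Fin n → V p) (step : ∀ j → Adj p (f j) (f (next j))) (a : Fin n) where
    run : ∀ {lo hi} → lo ≤′ hi → Walk (Adj p) (f (shift a lo)) (f (shift a hi))
    run ≤′-refl = [ _ ]
    run (≤′-step le) = run le ++w (_ ∷⟨ step _ ⟩ [ _ ])

    run-verts : ∀ {lo hi t} (le : lo ≤′ hi) → t ∈ verts (run le) → Σ ℕ λ o → lo ≤ o × o ≤ hi × t ≡ f (shift a o)
    run-verts {lo} ≤′-refl (here refl) = lo , ℕ.≤-refl , ℕ.≤-refl , refl
    run-verts (≤′-step le) t∈ with ++w-∈ (run le) _ t∈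
    ... | inj₁ t∈' = let (o , lo≤o , o≤hi , e) = run-verts le t∈' in o , lo≤o , ℕ.m≤n⇒m≤1+n o≤hi , e
    ... | inj₂ (here refl) = _ , ℕ.≤′⇒≤ le , ℕ.n≤1+n _ , refl
    ... | inj₂ (there (here refl)) = _ , ℕ.≤′⇒≤ (≤′-step le) , ℕ.≤-refl , refl

  -- Four routes between w_a and w_b = w_{a+k} (0 < k < n), pairwise meeting only at
  -- their ends: along C'' forwards and backwards, and along C' forwards and backwards.
  module Arcs (a : Fin n) (k' : ℕ) (k<n : suc k' < n) where
    k : ℕ
    k = suc k'
    b : Fin n
    b = shift a k
    open Run cw w-w a renaming (run to runW; run-verts to runW-verts)
    open Run cv v-v a renaming (run to runV; run-verts to runV-verts)

    Ends : List (V p)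
    Ends = cw a ∷ cw b ∷ []

    OnW : ℕ → ℕ → V p → Set
    OnW lo hi t = Σ ℕ λ o → lo ≤ o × o ≤ hi × t ≡ cw (shift a o)

    OnV : ℕ → ℕ → V p → Set
    OnV lo hi t = t ∈ Ends ⊎ Σ ℕ λ o → lo ≤ o × o ≤ hi × t ≡ cv (shift a o)

    n-1 : ℕ
    n-1 = n ∸ 1

    n-1+1 : suc n-1 ≡ n
    n-1+1 = ℕ.m+[n∸m]≡n (ℕ.≤-trans (s≤s z≤n) k<n)

    0≤′k : 0 ≤′ k
    0≤′k = ℕ.≤⇒≤′ z≤n

    k≤′n : k ≤′ n
    k≤′n = ℕ.≤⇒≤′ (ℕ.<⇒≤ k<n)

    0≤′k' : 0 ≤′ k'
    0≤′k' = ℕ.≤⇒≤′ z≤n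

    k≤′n-1 : k ≤′ n-1
    k≤′n-1 = ℕ.≤⇒≤′ (ℕ.∸-monoˡ-≤ 1 k<n)

    closes : ∀ {m} → m ≡ n → cw {p} (shift a m) ≡ cw a
    closes refl = cong cw (shift-n a)

    forwardW : Walk (Adj p) (cw a) (cw b)
    forwardW = runW 0≤′k

    forwardW-verts : ∀ {t} → t ∈ verts forwardW → OnW 0 k t
    forwardW-verts = runW-verts 0≤′k

    backwardW : Walk (Adj p) (cw a) (cw b)
    backwardW = proj₁ (reverseW Adj-sym (retarget (closes refl) (runW k≤′n)))

    backwardW-verts : ∀ {t} → t ∈ verts backwardW → OnW k n t
    backwardW-verts {t} t∈ =
      runW-verts k≤′n (subst (t ∈_) (verts-retarget (closes refl) (runW k≤′n)) (proj₂ (reverseW Adj-sym _) t∈))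

    enteringV : Walk (Adj p) (cv (shift a k')) (cw b)
    enteringV = _ ∷⟨ v-w⁺ _ ⟩ [ cw b ]

    forwardV : Walk (Adj p) (cw a) (cw b)
    forwardV = cw a ∷⟨ Adj-sym (v-w a) ⟩ (runV 0≤′k' ++w enteringV)

    forwardV-verts : ∀ {t} → t ∈ verts forwardV → OnV 0 k' t
    forwardV-verts (here e) = inj₁ (here e)
    forwardV-verts (there t∈) with ++w-∈ (runV 0≤′k') enteringV t∈
    ... | inj₁ t∈' = inj₂ (runV-verts 0≤′k' t∈')
    ... | inj₂ (here e) = inj₂ (k' , z≤n , ℕ.≤-refl , e)
    ... | inj₂ (there (here e)) = inj₁ (there (here e))

    closingV : Walk (Adj p) (cv (shift a n-1)) (cw (shift a (suc n-1)))
    closingV = _ ∷⟨ v-w⁺ _ ⟩ [ _ ]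

    aroundV : Walk (Adj p) (cv b) (cw (shift a (suc n-1)))
    aroundV = runV k≤′n-1 ++w closingV

    backwardV' : Walk (Adj p) (cw b) (cw a)
    backwardV' = cw b ∷⟨ Adj-sym (v-w b) ⟩ retarget (closes n-1+1) aroundV

    backwardV : Walk (Adj p) (cw a) (cw b)
    backwardV = proj₁ (reverseW Adj-sym backwardV')

    backwardV-verts : ∀ {t} → t ∈ verts backwardV → OnV k n-1 t
    backwardV-verts t∈ = on (proj₂ (reverseW Adj-sym backwardV') t∈)
      where
      on : ∀ {t} → t ∈ verts backwardV' → OnV k n-1 t
      on (here e) = inj₁ (there (here e))
      on {t} (there t∈) with ++w-∈ (runV k≤′n-1) closingV (subst (t ∈_) (verts-retarget (closes n-1+1) aroundV) t∈)
      ... | inj₁ t∈' = inj₂ (runV-verts k≤′n-1 t∈')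
      ... | inj₂ (here e) = inj₂ (n-1 , ℕ.∸-monoˡ-≤ 1 k<n , ℕ.≤-refl , e)
      ... | inj₂ (there (here refl)) = inj₁ (here (closes n-1+1))

    n-1<n : n-1 < n
    n-1<n = subst (n-1 <_) n-1+1 ℕ.≤-refl

    w-meets-v : ∀ {lo hi lo' hi' t} → OnW lo hi t → OnV lo' hi' t → t ∈ Ends
    w-meets-v _ (inj₁ t∈) = t∈
    w-meets-v (_ , _ , _ , refl) (inj₂ (_ , _ , _ , ()))

    -- the two routes along C'' overlap only at w_a (position 0 = n) and w_b (position k)
    w-meets-w : ∀ {t} → OnW 0 k t → OnW k n t → t ∈ Ends
    w-meets-w (o , _ , o≤k , refl) (o' , k≤o' , o'≤n , e) with o ℕ.≟ k | o' ℕ.≟ n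
    ... | yes refl | _ = there (here refl)
    ... | no _ | yes refl = here (trans e (cong cw (shift-n a)))
    ... | no o≢k | no o'≢n = ⊥-elim (ℕ.<⇒≱ o<k (subst (k ≤_) (sym o≡o') k≤o'))
      where
      o<k : o < k
      o<k = ℕ.≤∧≢⇒< o≤k o≢k
      o≡o' : o ≡ o'
      o≡o' = shift-injective a (ℕ.<-trans o<k k<n) (ℕ.≤∧≢⇒< o'≤n o'≢n) (cw-injective e)

    -- the two routes along C' use the disjoint position ranges [0, k) and [k, n)
    v-meets-v : ∀ {t} → OnV 0 k' t → OnV k n-1 t → t ∈ Ends
    v-meets-v (inj₁ t∈) _ = t∈
    v-meets-v (inj₂ _) (inj₁ t∈) = t∈
    v-meets-v (inj₂ (o , _ , o≤k' , refl)) (inj₂ (o' , k≤o' , o'≤n-1 , e)) =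
      ⊥-elim (ℕ.<⇒≱ (s≤s o≤k') (subst (k ≤_) (sym o≡o') k≤o'))
      where
      o≡o' : o ≡ o'
      o≡o' = shift-injective a (ℕ.<-trans (s≤s o≤k') k<n) (ℕ.≤-<-trans o'≤n-1 n-1<n) (cv-injective e)

    routes : List (Walk (Adj p) (cw a) (cw b))
    routes = forwardW ∷ backwardW ∷ forwardV ∷ backwardV ∷ []

    routes-meet : AllPairs (PairwiseMeetIn verts Ends) routes
    routes-meet =
        ((λ t∈ t∈' → w-meets-w (forwardW-verts t∈) (backwardW-verts t∈'))
         ∷ (λ t∈ t∈' → w-meets-v (forwardW-verts t∈) (forwardV-verts t∈'))
         ∷ (λ t∈ t∈' → w-meets-v (forwardW-verts t∈) (backwardV-verts t∈')) ∷ [])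
      ∷ ((λ t∈ t∈' → w-meets-v (backwardW-verts t∈) (forwardV-verts t∈'))
         ∷ (λ t∈ t∈' → w-meets-v (backwardW-verts t∈) (backwardV-verts t∈')) ∷ [])
      ∷ ((λ t∈ t∈' → v-meets-v (forwardV-verts t∈) (backwardV-verts t∈')) ∷ [])
      ∷ [] ∷ []

    avoid-z : All (λ r → cz ∉ verts r) routes
    avoid-z = (λ z∈ → onW (forwardW-verts z∈)) ∷ (λ z∈ → onW (backwardW-verts z∈))
            ∷ (λ z∈ → onV (forwardV-verts z∈)) ∷ (λ z∈ → onV (backwardV-verts z∈)) ∷ []
      where
      onW : ∀ {lo hi} → ¬ OnW lo hi cz
      onW (_ , _ , _ , ())
      onV : ∀ {lo hi} → ¬ OnV lo hi cz
      onV (inj₁ (here ()))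
      onV (inj₁ (there (here ())))
      onV (inj₂ (_ , _ , _ , ()))

  -- with z deleted, the at most 3 other deleted vertices miss one of the four arcs
  around-C'' : ∀ S → length S ≤ 4 → cz ∈ S → ∀ a k' (k<n : suc k' < n) → cw a ∉ S → cw (shift a (suc k')) ∉ S →
               Σ (Walk (Adj p) (cw a) (cw (shift a (suc k')))) λ w → Avoids S (verts w)
  around-C'' S |S|≤4 z∈ a k' k<n a∉ b∉ =
    let (w , w∈ , av) = route-avoiding verts Ends S∖s routes routes-meet (a∉ ∘ ⊆S ∷ b∉ ∘ ⊆S ∷ [])
                          (ℕ.<-≤-trans (shorter z∈) |S|≤4)
    in w , avoids-S av (All.tabulate λ t∈ t≡z → All.lookup avoid-z w∈ (subst (_∈ verts w) t≡z t∈))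
    where
    open Arcs a k' k<n
    open Delete S cz

  joinC'' : ∀ S → length S ≤ 4 → ∀ a b → cw a ∉ S → cw b ∉ S → Σ (Walk (Adj p) (cw a) (cw b)) λ w → Avoids S (verts w)
  joinC'' S |S|≤4 a b a∉ b∉ with a Fin.≟ b | cz ∈? S
    where open import Data.List.Membership.DecPropositional _≟_ using (_∈?_)
  ... | yes refl | _ = [ cw a ] , a∉ ∷ []
  ... | no _ | no z∉ = (cw a ∷⟨ w-z a ⟩ cz ∷⟨ Adj-sym (w-z b) ⟩ [ cw b ]) , a∉ ∷ z∉ ∷ b∉ ∷ []
  ... | no a≢b | yes z∈ with offset a b
  ...   | zero , _ , a≡b = ⊥-elim (a≢b a≡b)
  ...   | suc k' , k<n , refl = around-C'' S |S|≤4 z∈ a k' k<n a∉ b∉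

  -- κ(F_p) ≥ 5: walk from x into C'', along C'', and out to y; shortcut to a path
  kappa : KappaAtLeast5 p
  kappa S |S|≤4 x y x∉ y∉ =
    let (a , wx , avx) = reachC'' S |S|≤4 x x∉
        (b , wy , avy) = reachC'' S |S|≤4 y y∉
        (wab , avab) = joinC'' S |S|≤4 a b (avoids-∈ avx (end∈ wx)) (avoids-∈ avy (end∈ wy))
        (wy' , sub) = reverseW Adj-sym wy
        (P , isPath , P⊆) = pathIn (wx ++w (wab ++w wy'))
    in P , isPath , anti-mono P⊆ (++w-avoids wx _ avx (++w-avoids wab wy' avab (anti-mono sub avy)))

lemma8 : (p : ℕ) → 3 ≤ p →
    KappaAtLeast5 p
    × ((x : V p) (M : List (V p)) → Unique M → All OnC M → length M ≤ 5 → Fan p x M)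
    × ((M1 M2 : List (V p)) → Unique M1 → Unique M2 → All OnC M1 → All OnC M2 →
         length M1 ≡ length M2 → length M1 ≤ 5 → DisjointPaths p M1 M2)
lemma8 p p≥3 = κ≥5 , (λ x M uM _ |M|≤5 → FanAt.fan 4 κ≥5 x M uM |M|≤5) ,
               (λ M₁ M₂ u₁ u₂ _ _ same |M₁|≤5 → linkage 4 κ≥5 M₁ M₂ u₁ u₂ same |M₁|≤5)
  where
  open FpGraph p
  open FromConnectivity _≟_ vertices all-vertices (Adj p) Adj? Adj-sym
  κ≥5 : KappaAtLeast5 p
  κ≥5 = FpConnectivity.kappa p p≥3
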